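{- Let $G$ be a finite simple graph containing no ISK4 and no $K_{3,3}$. Then no two appendices of a hole of $G$ are crossing.
   Context: $G$ contains $H$ if $H$ is isomorphic to an induced subgraph of $G$. An ISK4 is an induced subgraph that is a subdivision of $K_4$. A hole is a chordless (induced) cycle of length at least 4. For a hole $H$ of $G$, a chordless path $P=p_1\dots p_k$ in $G\setminus V(H)$ is an appendix of $H$ if no vertex of $P\setminus\{p_1,p_k\}$ has a neighbor in $H$ and either (i) $k=1$, $N(p_1)\cap V(H)=\{u_1,u_2\}$ with $u_1u_2$ not an edge, or (ii) $k>1$, $N(p_1)\cap V(H)=\{u_1\}$, $N(p_k)\cap V(H)=\{u_2\}$ and $u_1\ne u_2$. Then $\{u_1,u_2\}$ is the attachment of $P$, and the two $u_1u_2$-subpaths of $H$ are the sectors of $H$ w.r.t. $P$. Two appendices $P$, $Q$ of $H$ with attachments $\{u_1,u_2\}$, $\{v_1,v_2\}$ are crossing if $\{u_1,u_2\}\cap\{v_1,v_2\}=\emptyset$ and one sector of $H$ w.r.t. $P$ contains $v_1$ while the other contains $v_2$. -}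

module Defs where

open import Data.Nat using (ℕ; zero; suc; _+_; _<_; _<ᵇ_; _%_)
open import Data.Fin using (Fin; zero; suc; toℕ; fromℕ)
open import Data.Fin.Patterns using (0F; 1F; 2F; 3F)
open import Data.Bool using (Bool; true; false; _xor_)
open import Data.Bool.Properties using (xor-same)
open import Data.List using (List; []; _∷_; _++_; [_]; map; concat)
open import Data.List.Membership.Propositional using (_∈_)
open import Data.List.Relation.Unary.Unique.Propositional using (Unique)
open import Data.Product using (Σ; ∃; _×_; _,_)
open import Data.Sum using (_⊎_)
open import Relation.Binary.PropositionalEquality using (_≡_; _≢_; refl)
open import Relation.Nullary using (¬_)
open import Function using (_⇔_)
open import Function.Definitions using (Injective)

record Graph (n : ℕ) : Set where
  field
    adj    : Fin n → Fin n → Bool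
    sym    : ∀ u v → adj u v ≡ adj v u
    irrefl : ∀ u → adj u u ≡ false

open Graph public

E : ∀ {n} → Graph n → Fin n → Fin n → Set
E G u v = adj G u v ≡ true

Contains : ∀ {n m} → Graph n → Graph m → Set
Contains {n} {m} G H =
  Σ (Fin m → Fin n) λ f → Injective _≡_ _≡_ f × (∀ u v → adj H u v ≡ adj G (f u) (f v))

-- K_{3,3}: sides {0,1,2} and {3,4,5}

private
  xor-comm : ∀ x y → x xor y ≡ y xor x
  xor-comm false false = refl
  xor-comm false true  = refl
  xor-comm true  false = refl
  xor-comm true  true  = refl

K33 : Graph 6
K33 = record
  { adj    = λ u v → (toℕ u <ᵇ 3) xor (toℕ v <ᵇ 3)
  ; sym    = λ u v → xor-comm (toℕ u <ᵇ 3) (toℕ v <ᵇ 3)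
  ; irrefl = λ u → xor-same (toℕ u <ᵇ 3)
  }

k4src k4tgt : Fin 6 → Fin 4
k4src 0F = 0F
k4src 1F = 0F
k4src 2F = 0F
k4src 3F = 1F
k4src (suc (suc (suc (suc zero)))) = 1F
k4src (suc (suc (suc (suc (suc zero))))) = 2F
k4tgt 0F = 1F
k4tgt 1F = 2F
k4tgt 2F = 3F
k4tgt 3F = 2F
k4tgt (suc (suc (suc (suc zero)))) = 3F
k4tgt (suc (suc (suc (suc (suc zero))))) = 3F

data Consec {A : Set} : List A → A → A → Set where
  here-fw : ∀ {x y xs} → Consec (x ∷ y ∷ xs) x y
  here-bw : ∀ {x y xs} → Consec (x ∷ y ∷ xs) y x
  there   : ∀ {x xs u v} → Consec xs u v → Consec (x ∷ xs) u v

allFin4 : List (Fin 4)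
allFin4 = 0F ∷ 1F ∷ 2F ∷ 3F ∷ []

allFin6 : List (Fin 6)
allFin6 = 0F ∷ 1F ∷ 2F ∷ 3F ∷ suc (suc (suc (suc zero))) ∷ suc (suc (suc (suc (suc zero)))) ∷ []

-- H is a subdivision of K4: four branch vertices, and for each edge of K4
-- a path between the corresponding branch vertices (given by its list of
-- internal vertices); every vertex of H is exactly once a branch vertex or
-- an internal vertex of one path, and the edges of H are exactly the
-- edges of these paths.
record IsSubdivisionOfK4 {m : ℕ} (H : Graph m) : Set where
  field
    branch   : Fin 4 → Fin m
    internal : Fin 6 → List (Fin m)
  pathOf : Fin 6 → List (Fin m)
  pathOf e = branch (k4src e) ∷ internal e ++ [ branch (k4tgt e) ]
  allVerts : List (Fin m)
  allVerts = map branch allFin4 ++ concat (map internal allFin6)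
  field
    verts-unique : Unique allVerts
    verts-cover  : ∀ v → v ∈ allVerts
    edges        : ∀ u v → E H u v ⇔ (∃ λ e → Consec (pathOf e) u v)

HasISK4 : ∀ {n} → Graph n → Set
HasISK4 G = Σ ℕ λ m → Σ (Graph m) λ H → IsSubdivisionOfK4 H × Contains G H

-- Holes: chordless cycles h 0, h 1, ..., h (k-1), h 0 with k = 4 + m ≥ 4

CycAdj : ∀ {k} → Fin (suc k) → Fin (suc k) → Set
CycAdj {k} i j = (suc (toℕ i) % suc k ≡ toℕ j) ⊎ (suc (toℕ j) % suc k ≡ toℕ i)

record Hole {n : ℕ} (G : Graph n) : Set where
  field
    len-4 : ℕ
    h     : Fin (4 + len-4) → Fin n
    h-inj : Injective _≡_ _≡_ h
    h-cyc : ∀ i j → E G (h i) (h j) ⇔ CycAdj i j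

open Hole public

HIdx : ∀ {n} {G : Graph n} → Hole G → Set
HIdx H = Fin (4 + len-4 H)

-- c lies on the subpath of the hole going from index a to index b
-- in increasing (cyclic) index order, endpoints included
InSector : ∀ {k} → Fin k → Fin k → Fin k → Set
InSector a b c =
  c ≡ a ⊎ c ≡ b ⊎
  (toℕ a < toℕ c × toℕ c < toℕ b) ⊎
  (toℕ b < toℕ a × (toℕ a < toℕ c ⊎ toℕ c < toℕ b))

record Appendix {n : ℕ} {G : Graph n} (H : Hole G) : Set where
  field
    l     : ℕ
    p     : Fin (suc l) → Fin n
    p-inj : Injective _≡_ _≡_ p
    p-chordless : ∀ i j → E G (p i) (p j) ⇔ (suc (toℕ i) ≡ toℕ j ⊎ suc (toℕ j) ≡ toℕ i)
    p-off : ∀ i c → p i ≢ h H c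
    u₁ u₂ : HIdx H
    interior : ∀ i → 0 < toℕ i → toℕ i < l → ∀ c → ¬ E G (p i) (h H c)
    attach :
      (l ≡ 0 × u₁ ≢ u₂ × ¬ E G (h H u₁) (h H u₂) ×
        (∀ c → E G (p zero) (h H c) ⇔ (c ≡ u₁ ⊎ c ≡ u₂)))
      ⊎
      (0 < l × u₁ ≢ u₂ ×
        (∀ c → E G (p zero) (h H c) ⇔ c ≡ u₁) ×
        (∀ c → E G (p (fromℕ l)) (h H c) ⇔ c ≡ u₂))

open Appendix public

Crossing : ∀ {n} {G : Graph n} {H : Hole G} → Appendix H → Appendix H → Set
Crossing {H = H} P Q =
  h H (u₁ P) ≢ h H (u₁ Q) × h H (u₁ P) ≢ h H (u₂ Q) ×
  h H (u₂ P) ≢ h H (u₁ Q) × h H (u₂ P) ≢ h H (u₂ Q) ×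
  ((InSector (u₁ P) (u₂ P) (u₁ Q) × InSector (u₂ P) (u₁ P) (u₂ Q)) ⊎
   (InSector (u₁ P) (u₂ P) (u₂ Q) × InSector (u₂ P) (u₁ P) (u₁ Q)))

module Submission where

-- Let P and Q be appendices of a hole with crossing attachments {u₁, u₂} and {v₁, v₂}.
-- If no vertex of P equals or is adjacent to a vertex of Q, the hole together with P and Q
-- is an ISK4 with branch vertices u₁, v₁, u₂, v₂. Otherwise let x be the first vertex of P
-- (starting from u₁) that touches Q, and y, y′ the first and the last neighbour of x on Q.
-- The hole, the part of P from u₁ to x and suitable parts of Q again form an ISK4: a vertex
-- joined by three paths to u₁, v₁, v₂ (centred at y if y = y′, and at x otherwise), or, when
-- y y′ is an edge, the triangle x y y′ joined to u₁, v₁, v₂ with the arc from v₁ to v₂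
-- through u₂ left out. The exception is when P and Q are single adjacent vertices: then an
-- arc between consecutive attachments can be left out, unless the hole has length four, in
-- which case the hole, P and Q induce K3,3.

open import Defs hiding (sym)
open import Data.Bool using (true; false)
import Data.Bool as Bool
open import Data.Bool.Properties using (¬-not)
open import Data.Empty using (⊥; ⊥-elim)
open import Data.Fin using (Fin; zero; suc; toℕ; fromℕ; inject₁; _≟_)
open import Data.Fin.Patterns using (0F; 1F; 2F; 3F; 4F; 5F)
open import Data.Fin.Properties using (toℕ-injective; toℕ-fromℕ; toℕ<n)
open import Data.List using (List; []; _∷_; _++_; [_]; map; concat; length; lookup; reverse; _∷ʳ_; tabulate; initLast; _∷ʳ′_)
open import Data.List.Properties
  using (++-assoc; ∷ʳ-++; ++-identityʳ; reverse-++; reverse-involutive; unfold-reverse; map-++; map-cong; map-∘; concat-map)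
open import Data.List.Membership.Propositional using (_∈_; _∉_; mapWith∈; find; lose)
open import Data.List.Membership.Propositional.Properties
  using (∈-++⁺ˡ; ∈-++⁺ʳ; ∈-++⁻; ∈-lookup; ∈-map⁺; ∈-map⁻; ∈-concat⁺′; ∈-tabulate⁻; map-mapWith∈; mapWith∈-cong; mapWith∈-id)
open import Data.List.Relation.Unary.All using (All; []; _∷_)
import Data.List.Relation.Unary.All as All
open import Data.List.Relation.Unary.All.Properties using (¬Any⇒All¬)
open import Data.List.Relation.Unary.AllPairs using ([]; _∷_)
open import Data.List.Relation.Unary.Any using (Any; here; there; index; any?)
open import Data.List.Relation.Unary.Any.Properties using (lookup-index; reverse⁺; reverse⁻)
open import Data.List.Relation.Unary.First using (FirstView) renaming (_++_∷_ to first-view)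
open import Data.List.Relation.Unary.First.Properties using (cofirst?; toView; ¬First⇒All)
open import Data.List.Relation.Unary.Unique.Propositional using (Unique)
open import Data.List.Relation.Unary.Unique.Propositional.Properties using (Unique[x∷xs]⇒x∉xs; ++⁺; map⁻; tabulate⁺)
open import Data.List.Relation.Binary.Permutation.Propositional using (_↭_; ↭-refl; ↭-sym; ↭-trans; prep; ↭⇒↭ₛ)
open import Data.List.Relation.Binary.Permutation.Propositional.Properties
  using (↭-reverse; ∈-resp-↭; ++-commutativeMonoid) renaming (++⁺ to ↭-++⁺; ++⁺ˡ to ↭-++⁺ˡ)
open import Data.List.Relation.Binary.Permutation.Setoid.Properties using (Unique-resp-↭)
open import Data.Nat using (ℕ; zero; suc; _+_; _<_; _≤_; z≤n; s≤s; _%_; pred)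
open import Data.Nat.DivMod using (m<n⇒m%n≡m; n%n≡0)
open import Data.Nat.Properties using (≤∧≢⇒<; m≤n⇒m<n∨m≡n; <-asym; <-trans; ≤-pred; n≤0⇒n≡0)
open import Data.Product using (∃; _×_; _,_; proj₁; proj₂)
open import Data.Sum using (_⊎_; inj₁; inj₂; [_,_]′; swap)
open import Function using (_∘_; _⇔_; mk⇔; Equivalence)
open import Function.Definitions using (Injective)
open import Relation.Binary.PropositionalEquality using (_≡_; _≢_; refl; sym; trans; cong; cong₂; subst; setoid; module ≡-Reasoning)
open import Relation.Nullary using (¬_; Dec; yes; no)
open import Relation.Nullary.Decidable using (_⊎-dec_)
open import Relation.Unary using (Decidable; ∁)

module _ {A : Set} where

  consec-∈ˡ : ∀ {xs : List A} {x y} → Consec xs x y → x ∈ xs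
  consec-∈ˡ here-fw   = here refl
  consec-∈ˡ here-bw   = there (here refl)
  consec-∈ˡ (there c) = there (consec-∈ˡ c)

  consec-∈ʳ : ∀ {xs : List A} {x y} → Consec xs x y → y ∈ xs
  consec-∈ʳ here-fw   = there (here refl)
  consec-∈ʳ here-bw   = here refl
  consec-∈ʳ (there c) = there (consec-∈ʳ c)

  consec-sym : ∀ {xs : List A} {x y} → Consec xs x y → Consec xs y x
  consec-sym here-fw   = here-bw
  consec-sym here-bw   = here-fw
  consec-sym (there c) = there (consec-sym c)

  consec-++⁺ˡ : ∀ {xs ys : List A} {x y} → Consec xs x y → Consec (xs ++ ys) x y
  consec-++⁺ˡ here-fw   = here-fw
  consec-++⁺ˡ here-bw   = here-bw
  consec-++⁺ˡ (there c) = there (consec-++⁺ˡ c)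

  consec-++⁺ʳ : ∀ (xs : List A) {ys x y} → Consec ys x y → Consec (xs ++ ys) x y
  consec-++⁺ʳ []       c = c
  consec-++⁺ʳ (_ ∷ xs) c = there (consec-++⁺ʳ xs c)

  consec-middle : ∀ (xs : List A) {x y ys} → Consec (xs ++ x ∷ y ∷ ys) x y
  consec-middle []       = here-fw
  consec-middle (_ ∷ xs) = there (consec-middle xs)

  -- "join": xs ++ s ∷ ys glues xs ∷ʳ s and s ∷ ys along their common vertex s.
  consec-join⁻ : ∀ (xs : List A) {s ys x y} → Consec (xs ++ s ∷ ys) x y →
                 Consec (xs ∷ʳ s) x y ⊎ Consec (s ∷ ys) x y
  consec-join⁻ []           c         = inj₂ c
  consec-join⁻ (_ ∷ [])     here-fw   = inj₁ here-fw
  consec-join⁻ (_ ∷ [])     here-bw   = inj₁ here-bw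
  consec-join⁻ (_ ∷ [])     (there c) = inj₂ c
  consec-join⁻ (_ ∷ _ ∷ _)  here-fw   = inj₁ here-fw
  consec-join⁻ (_ ∷ _ ∷ _)  here-bw   = inj₁ here-bw
  consec-join⁻ (_ ∷ w ∷ xs) (there c) with consec-join⁻ (w ∷ xs) c
  ... | inj₁ d = inj₁ (there d)
  ... | inj₂ d = inj₂ d

  consec-join⁺ˡ : ∀ (xs : List A) {s ys x y} → Consec (xs ∷ʳ s) x y → Consec (xs ++ s ∷ ys) x y
  consec-join⁺ˡ []           (there ())
  consec-join⁺ˡ (_ ∷ [])     here-fw           = here-fw
  consec-join⁺ˡ (_ ∷ [])     here-bw           = here-bw
  consec-join⁺ˡ (_ ∷ [])     (there (there ()))
  consec-join⁺ˡ (_ ∷ _ ∷ _)  here-fw           = here-fw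
  consec-join⁺ˡ (_ ∷ _ ∷ _)  here-bw           = here-bw
  consec-join⁺ˡ (_ ∷ w ∷ xs) (there c)         = there (consec-join⁺ˡ (w ∷ xs) c)

  consec-reverse⁺ : ∀ {xs : List A} {x y} → Consec xs x y → Consec (reverse xs) x y
  consec-reverse⁺ {x ∷ y ∷ xs} here-fw =
    subst (λ l → Consec l x y) (sym (reverse-++ (x ∷ y ∷ []) xs)) (consec-++⁺ʳ (reverse xs) here-bw)
  consec-reverse⁺ {x ∷ y ∷ xs} here-bw =
    subst (λ l → Consec l y x) (sym (reverse-++ (x ∷ y ∷ []) xs)) (consec-++⁺ʳ (reverse xs) here-fw)
  consec-reverse⁺ {z ∷ xs}     (there c) =
    subst (λ l → Consec l _ _) (sym (unfold-reverse z xs)) (consec-++⁺ˡ (consec-reverse⁺ c))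

  consec-reverse⁻ : ∀ {xs : List A} {x y} → Consec (reverse xs) x y → Consec xs x y
  consec-reverse⁻ {xs} c = subst (λ l → Consec l _ _) (reverse-involutive xs) (consec-reverse⁺ c)

  reverse-∷-∷ʳ : ∀ (x : A) L t → reverse (x ∷ L ∷ʳ t) ≡ t ∷ reverse L ∷ʳ x
  reverse-∷-∷ʳ x L t = begin
    reverse ((x ∷ L) ++ [ t ])  ≡⟨ reverse-++ (x ∷ L) [ t ] ⟩
    t ∷ reverse (x ∷ L)         ≡⟨ cong (t ∷_) (unfold-reverse x L) ⟩
    t ∷ reverse L ∷ʳ x          ∎
    where open ≡-Reasoning

  consec-reverse-∷ʳ⁺ : ∀ {s L t x y} → Consec (s ∷ L ∷ʳ t) x y → Consec (t ∷ reverse L ∷ʳ s) x y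
  consec-reverse-∷ʳ⁺ {s} {L} {t} c = subst (λ l → Consec l _ _) (reverse-∷-∷ʳ s L t) (consec-reverse⁺ c)

  consec-reverse-∷ʳ⁻ : ∀ s L t {x y} → Consec (t ∷ reverse L ∷ʳ s) x y → Consec (s ∷ L ∷ʳ t) x y
  consec-reverse-∷ʳ⁻ s L t c = consec-reverse⁻ (subst (λ l → Consec l _ _) (sym (reverse-∷-∷ʳ s L t)) c)

  consec-via⁺ : ∀ (a : A) X s R t {x y} → Consec (a ∷ X ∷ʳ s) x y ⊎ Consec (s ∷ R ∷ʳ t) x y →
                Consec (a ∷ (X ++ s ∷ R) ∷ʳ t) x y
  consec-via⁺ a X s R t (inj₁ c) = subst (λ l → Consec (a ∷ l) _ _) (sym (++-assoc X (s ∷ R) [ t ])) (consec-join⁺ˡ (a ∷ X) c)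
  consec-via⁺ a X s R t (inj₂ c) = subst (λ l → Consec (a ∷ l) _ _) (sym (++-assoc X (s ∷ R) [ t ])) (consec-++⁺ʳ (a ∷ X) c)

  consec-via⁻ : ∀ (a : A) X s R t {x y} → Consec (a ∷ (X ++ s ∷ R) ∷ʳ t) x y →
                Consec (a ∷ X ∷ʳ s) x y ⊎ Consec (s ∷ R ∷ʳ t) x y
  consec-via⁻ a X s R t c = consec-join⁻ (a ∷ X) (subst (λ l → Consec (a ∷ l) _ _) (++-assoc X (s ∷ R) [ t ]) c)

module _ {A B : Set} (f : A → B) where

  consec-map⁺ : ∀ {xs : List A} {x y} → Consec xs x y → Consec (map f xs) (f x) (f y)
  consec-map⁺ here-fw   = here-fw
  consec-map⁺ here-bw   = here-bw
  consec-map⁺ (there c) = there (consec-map⁺ c)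

  consec-map⁻ : ∀ (xs : List A) {u v} → Consec (map f xs) u v →
                ∃ λ x → ∃ λ y → Consec xs x y × u ≡ f x × v ≡ f y
  consec-map⁻ (x ∷ y ∷ xs) here-fw   = x , y , here-fw , refl , refl
  consec-map⁻ (x ∷ y ∷ xs) here-bw   = y , x , here-bw , refl , refl
  consec-map⁻ (x ∷ xs)     (there c) with consec-map⁻ xs c
  ... | x′ , y′ , d , p , q = x′ , y′ , there d , p , q

  consec-map⁻-injective : (∀ {a b} → f a ≡ f b → a ≡ b) → ∀ xs {x y} → Consec (map f xs) (f x) (f y) → Consec xs x y
  consec-map⁻-injective f-inj xs c with consec-map⁻ xs c
  ... | _ , _ , d , p , q rewrite f-inj p | f-inj q = d

module _ {A : Set} where

  Unique-∷ : ∀ {x} {xs : List A} → x ∉ xs → Unique xs → Unique (x ∷ xs)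
  Unique-∷ {xs = xs} x∉xs u = ¬Any⇒All¬ xs x∉xs ∷ u

  Unique-tail : ∀ {x} {xs : List A} → Unique (x ∷ xs) → Unique xs
  Unique-tail (_ ∷ u) = u

  Unique-++⁻ˡ : ∀ (xs : List A) {ys} → Unique (xs ++ ys) → Unique xs
  Unique-++⁻ˡ []       u = []
  Unique-++⁻ˡ (x ∷ xs) u =
    Unique-∷ (λ m → Unique[x∷xs]⇒x∉xs u (∈-++⁺ˡ m)) (Unique-++⁻ˡ xs (Unique-tail u))

  Unique-++⁻ʳ : ∀ (xs : List A) {ys} → Unique (xs ++ ys) → Unique ys
  Unique-++⁻ʳ []       u = u
  Unique-++⁻ʳ (x ∷ xs) u = Unique-++⁻ʳ xs (Unique-tail u)

  Unique-++-disjoint : ∀ (xs : List A) {ys v} → Unique (xs ++ ys) → v ∈ xs → v ∉ ys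
  Unique-++-disjoint (x ∷ xs) u (here refl) m = Unique[x∷xs]⇒x∉xs u (∈-++⁺ʳ xs m)
  Unique-++-disjoint (x ∷ xs) u (there p)   m = Unique-++-disjoint xs (Unique-tail u) p m

  Unique-join-meet : ∀ (xs : List A) {s ys v} → Unique (xs ++ s ∷ ys) →
                     v ∈ xs ∷ʳ s → v ∈ s ∷ ys → v ≡ s
  Unique-join-meet xs u m₁ (here p)   = p
  Unique-join-meet xs u m₁ (there m₂) with ∈-++⁻ xs m₁
  ... | inj₂ (here p) = p
  ... | inj₁ m        = ⊥-elim (Unique-++-disjoint xs u m (there m₂))

  Unique-reverse : ∀ {xs : List A} → Unique xs → Unique (reverse xs)
  Unique-reverse {xs} = Unique-resp-↭ (setoid A) (↭⇒↭ₛ (↭-sym (↭-reverse xs)))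

  lookup-injective : ∀ {xs : List A} → Unique xs → ∀ {i j} → lookup xs i ≡ lookup xs j → i ≡ j
  lookup-injective {x ∷ xs} u {zero}  {zero}  e = refl
  lookup-injective {x ∷ xs} u {zero}  {suc j} e = ⊥-elim (Unique[x∷xs]⇒x∉xs u (subst (_∈ xs) (sym e) (∈-lookup j)))
  lookup-injective {x ∷ xs} u {suc i} {zero}  e = ⊥-elim (Unique[x∷xs]⇒x∉xs u (subst (_∈ xs) e (∈-lookup i)))
  lookup-injective {x ∷ xs} u {suc i} {suc j} e = cong suc (lookup-injective (Unique-tail u) e)

  consec-head : ∀ {s t : A} {xs v} → Unique (s ∷ t ∷ xs) → Consec (s ∷ t ∷ xs) s v → v ≡ t
  consec-head u here-fw   = refl
  consec-head u here-bw   = ⊥-elim (Unique[x∷xs]⇒x∉xs u (here refl))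
  consec-head u (there c) = ⊥-elim (Unique[x∷xs]⇒x∉xs u (consec-∈ˡ c))

data LastView {A : Set} (P Q : A → Set) : List A → Set where
  last-view : ∀ xs {y ys} → Q y → All P ys → LastView P Q (xs ++ y ∷ ys)

module _ {A : Set} {D : A → Set} (D? : Decidable D) where

  first-satisfying : ∀ xs → All (∁ D) xs ⊎ FirstView (∁ D) D xs
  first-satisfying xs with cofirst? D? xs
  ... | yes f = inj₂ (toView f)
  ... | no ¬f = inj₁ (¬First⇒All (λ ¬d → ¬d) ¬f)

  last-satisfying : ∀ xs → All (∁ D) xs ⊎ LastView (∁ D) D xs
  last-satisfying []       = inj₁ []
  last-satisfying (x ∷ xs) with last-satisfying xs
  ... | inj₂ (last-view ys d ps) = inj₂ (last-view (x ∷ ys) d ps)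
  ... | inj₁ ps with D? x
  ...   | yes d = inj₂ (last-view [] d ps)
  ...   | no ¬d = inj₁ (¬d ∷ ps)

module _ {A : Set} where

  ++-∷-nonempty : ∀ (X : List A) b Y → ∃ λ m → ∃ λ M → X ++ b ∷ Y ≡ m ∷ M
  ++-∷-nonempty []      b Y = b , Y , refl
  ++-∷-nonempty (x ∷ X) b Y = x , X ++ b ∷ Y , refl

  ∈-rotate : ∀ (xs : List A) {ys x} → x ∈ ys ++ xs → x ∈ xs ++ ys
  ∈-rotate xs {ys} m with ∈-++⁻ ys m
  ... | inj₁ p = ∈-++⁺ʳ xs p
  ... | inj₂ p = ∈-++⁺ˡ p

  consec-predecessor : ∀ (a : A) xs {x ys} → ∃ λ p → (p ≡ a ⊎ p ∈ xs) × Consec (a ∷ xs ++ x ∷ ys) p x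
  consec-predecessor a []       = a , inj₁ refl , here-fw
  consec-predecessor a (y ∷ xs) with consec-predecessor y xs
  ... | p , inj₁ refl , c = p , inj₂ (here refl) , there c
  ... | p , inj₂ m    , c = p , inj₂ (there m) , there c

  reverse-∷ʳ-∷ʳ : ∀ (xs : List A) y z → reverse (xs ∷ʳ y ∷ʳ z) ≡ z ∷ y ∷ reverse xs
  reverse-∷ʳ-∷ʳ xs y z = trans (reverse-++ (xs ∷ʳ y) [ z ]) (cong (z ∷_) (reverse-++ xs [ y ]))

module _ {A : Set} where

  consec-tabulate⁺ : ∀ {m} (f : Fin m → A) i j → suc (toℕ i) ≡ toℕ j → Consec (tabulate f) (f i) (f j)
  consec-tabulate⁺ {suc (suc m)} f zero    (suc zero)    e = here-fw
  consec-tabulate⁺ {suc m}       f (suc i) (suc j)       e = there (consec-tabulate⁺ (f ∘ suc) i j (cong pred e))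

  consec-tabulate⁻ : ∀ {m} (f : Fin m → A) {x y} → Consec (tabulate f) x y →
                     ∃ λ i → ∃ λ j → x ≡ f i × y ≡ f j × (suc (toℕ i) ≡ toℕ j ⊎ suc (toℕ j) ≡ toℕ i)
  consec-tabulate⁻ {suc (suc m)} f here-fw = zero , suc zero , refl , refl , inj₁ refl
  consec-tabulate⁻ {suc (suc m)} f here-bw = suc zero , zero , refl , refl , inj₂ refl
  consec-tabulate⁻ {suc m} f (there c) with consec-tabulate⁻ (f ∘ suc) c
  ... | i , j , p , q , inj₁ e = suc i , suc j , p , q , inj₁ (cong suc e)
  ... | i , j , p , q , inj₂ e = suc i , suc j , p , q , inj₂ (cong suc e)

  tabulate-∷ʳ : ∀ {m} (f : Fin (suc m) → A) → tabulate f ≡ tabulate (f ∘ inject₁) ∷ʳ f (fromℕ m)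
  tabulate-∷ʳ {zero}  f = refl
  tabulate-∷ʳ {suc m} f = cong (f zero ∷_) (tabulate-∷ʳ (f ∘ suc))

  tabulate-split₁ : ∀ {m} (f : Fin m → A) i → ∃ λ L → ∃ λ R → tabulate f ≡ L ++ f i ∷ R
  tabulate-split₁ f zero    = [] , _ , refl
  tabulate-split₁ f (suc i) with tabulate-split₁ (f ∘ suc) i
  ... | L , R , eq = f zero ∷ L , R , cong (f zero ∷_) eq

  tabulate-split₂ : ∀ {m} (f : Fin m → A) i j → toℕ i < toℕ j →
                    ∃ λ L → ∃ λ M → ∃ λ R → tabulate f ≡ L ++ f i ∷ M ++ f j ∷ R
  tabulate-split₂ f zero    (suc j) _ with tabulate-split₁ (f ∘ suc) j
  ... | M , R , eq = [] , M , R , cong (f zero ∷_) eq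
  tabulate-split₂ f (suc i) (suc j) (s≤s i<j) with tabulate-split₂ (f ∘ suc) i j i<j
  ... | L , M , R , eq = f zero ∷ L , M , R , cong (f zero ∷_) eq

  tabulate-split₃ : ∀ {m} (f : Fin m → A) i j k → toℕ i < toℕ j → toℕ j < toℕ k →
                    ∃ λ L → ∃ λ M₁ → ∃ λ M₂ → ∃ λ R → tabulate f ≡ L ++ f i ∷ M₁ ++ f j ∷ M₂ ++ f k ∷ R
  tabulate-split₃ f zero    (suc j) (suc k) _ (s≤s j<k) with tabulate-split₂ (f ∘ suc) j k j<k
  ... | M₁ , M₂ , R , eq = [] , M₁ , M₂ , R , cong (f zero ∷_) eq
  tabulate-split₃ f (suc i) (suc j) (suc k) (s≤s i<j) (s≤s j<k) with tabulate-split₃ (f ∘ suc) i j k i<j j<k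
  ... | L , M₁ , M₂ , R , eq = f zero ∷ L , M₁ , M₂ , R , cong (f zero ∷_) eq

  tabulate-split₄ : ∀ {m} (f : Fin m → A) i j k l → toℕ i < toℕ j → toℕ j < toℕ k → toℕ k < toℕ l →
                    ∃ λ L → ∃ λ M₁ → ∃ λ M₂ → ∃ λ M₃ → ∃ λ R →
                    tabulate f ≡ L ++ f i ∷ M₁ ++ f j ∷ M₂ ++ f k ∷ M₃ ++ f l ∷ R
  tabulate-split₄ f zero    (suc j) (suc k) (suc l) _ (s≤s j<k) (s≤s k<l) with tabulate-split₃ (f ∘ suc) j k l j<k k<l
  ... | M₁ , M₂ , M₃ , R , eq = [] , M₁ , M₂ , M₃ , R , cong (f zero ∷_) eq
  tabulate-split₄ f (suc i) (suc j) (suc k) (suc l) (s≤s i<j) (s≤s j<k) (s≤s k<l) with tabulate-split₄ (f ∘ suc) i j k l i<j j<k k<l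
  ... | L , M₁ , M₂ , M₃ , R , eq = f zero ∷ L , M₁ , M₂ , M₃ , R , cong (f zero ∷_) eq

module InducedPaths {n : ℕ} (G : Graph n) where

  V : Set
  V = Fin n

  E-sym : ∀ {x y} → E G x y → E G y x
  E-sym {x} {y} e = trans (Graph.sym G y x) e

  E-irrefl : ∀ {x} → ¬ E G x x
  E-irrefl {x} e with trans (sym (Graph.irrefl G x)) e
  ... | ()

  E⇒≢ : ∀ {x y} → E G x y → x ≢ y
  E⇒≢ e refl = E-irrefl e

  E? : ∀ x y → Dec (E G x y)
  E? x y = adj G x y Bool.≟ true

  -- Paths and holes are lists of vertices; their edges are the Consec pairs.
  record InducedPath (L : List V) : Set where
    field
      unique      : Unique L
      edge⇒consec : ∀ {x y} → x ∈ L → y ∈ L → E G x y → Consec L x y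
      consec⇒edge : ∀ {x y} → Consec L x y → E G x y
  open InducedPath public

  path-edge : ∀ {x y} → E G x y → InducedPath (x ∷ y ∷ [])
  path-edge {x} {y} e = record
    { unique      = Unique-∷ (λ { (here p) → E⇒≢ e p }) (Unique-∷ (λ ()) [])
    ; edge⇒consec = edge⇒consec′
    ; consec⇒edge = λ { here-fw → e ; here-bw → E-sym e ; (there (there ())) } }
    where
    edge⇒consec′ : ∀ {a b} → a ∈ x ∷ y ∷ [] → b ∈ x ∷ y ∷ [] → E G a b → Consec (x ∷ y ∷ []) a b
    edge⇒consec′ (here refl)         (here refl)         e′ = ⊥-elim (E-irrefl e′)
    edge⇒consec′ (here refl)         (there (here refl)) e′ = here-fw
    edge⇒consec′ (there (here refl)) (here refl)         e′ = here-bw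
    edge⇒consec′ (there (here refl)) (there (here refl)) e′ = ⊥-elim (E-irrefl e′)

  path-join : ∀ (xs : List V) s ys → InducedPath (xs ∷ʳ s) → InducedPath (s ∷ ys) →
              (∀ {x y} → x ∈ xs ∷ʳ s → y ∈ s ∷ ys → E G x y → x ≡ s ⊎ y ≡ s) →
              (∀ {x} → x ∈ xs ∷ʳ s → x ∈ s ∷ ys → x ≡ s) →
              InducedPath (xs ++ s ∷ ys)
  path-join xs s ys P₁ P₂ cross-at-s meet-at-s = record
    { unique      = subst Unique (∷ʳ-++ xs s ys)
                      (++⁺ (unique P₁) (Unique-tail (unique P₂))
                           (λ (m₁ , m₂) → Unique[x∷xs]⇒x∉xs (unique P₂)
                                            (subst (_∈ ys) (meet-at-s m₁ (there m₂)) m₂)))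
    ; edge⇒consec = edge⇒consec′
    ; consec⇒edge = λ c → [ consec⇒edge P₁ , consec⇒edge P₂ ]′ (consec-join⁻ xs c) }
    where
    halves : ∀ {x} → x ∈ xs ++ s ∷ ys → x ∈ xs ∷ʳ s ⊎ x ∈ s ∷ ys
    halves m with ∈-++⁻ xs m
    ... | inj₁ p = inj₁ (∈-++⁺ˡ p)
    ... | inj₂ p = inj₂ p
    across : ∀ {x y} → x ∈ xs ∷ʳ s → y ∈ s ∷ ys → E G x y → Consec (xs ++ s ∷ ys) x y
    across m₁ m₂ e with cross-at-s m₁ m₂ e
    ... | inj₁ refl = consec-++⁺ʳ xs (edge⇒consec P₂ (here refl) m₂ e)
    ... | inj₂ refl = consec-join⁺ˡ xs (edge⇒consec P₁ m₁ (∈-++⁺ʳ xs (here refl)) e)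
    edge⇒consec′ : ∀ {x y} → x ∈ xs ++ s ∷ ys → y ∈ xs ++ s ∷ ys → E G x y → Consec (xs ++ s ∷ ys) x y
    edge⇒consec′ mx my e with halves mx | halves my
    ... | inj₁ p | inj₁ q = consec-join⁺ˡ xs (edge⇒consec P₁ p q e)
    ... | inj₂ p | inj₂ q = consec-++⁺ʳ xs (edge⇒consec P₂ p q e)
    ... | inj₁ p | inj₂ q = across p q e
    ... | inj₂ p | inj₁ q = consec-sym (across q p (E-sym e))

  path-cons : ∀ {v w R} → E G v w → v ∉ w ∷ R → (∀ {z} → z ∈ R → ¬ E G v z) →
              InducedPath (w ∷ R) → InducedPath (v ∷ w ∷ R)
  path-cons {v} {w} {R} e v∉ v≁R P = path-join [ v ] w R (path-edge e) P cross meet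
    where
    cross : ∀ {a b} → a ∈ v ∷ w ∷ [] → b ∈ w ∷ R → E G a b → a ≡ w ⊎ b ≡ w
    cross (there (here p)) _          _  = inj₁ p
    cross (here refl)      (here p)   _  = inj₂ p
    cross (here refl)      (there mb) e′ = ⊥-elim (v≁R mb e′)
    meet : ∀ {a} → a ∈ v ∷ w ∷ [] → a ∈ w ∷ R → a ≡ w
    meet (there (here p)) _ = p
    meet (here refl)      m = ⊥-elim (v∉ m)

  private
    join-mem⁺ˡ : ∀ (xs : List V) {s ys x} → x ∈ xs ∷ʳ s → x ∈ xs ++ s ∷ ys
    join-mem⁺ˡ xs {s} {ys} {x} m = subst (x ∈_) (∷ʳ-++ xs s ys) (∈-++⁺ˡ m)

  path-prefix : ∀ (xs : List V) s ys → InducedPath (xs ++ s ∷ ys) → InducedPath (xs ∷ʳ s)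
  path-prefix xs s ys P = record
    { unique      = Unique-++⁻ˡ (xs ∷ʳ s) (subst Unique (sym (∷ʳ-++ xs s ys)) (unique P))
    ; edge⇒consec = edge⇒consec′
    ; consec⇒edge = λ c → consec⇒edge P (consec-join⁺ˡ xs c) }
    where
    edge⇒consec′ : ∀ {x y} → x ∈ xs ∷ʳ s → y ∈ xs ∷ʳ s → E G x y → Consec (xs ∷ʳ s) x y
    edge⇒consec′ mx my e with consec-join⁻ xs (edge⇒consec P (join-mem⁺ˡ xs mx) (join-mem⁺ˡ xs my) e)
    ... | inj₁ d = d
    ... | inj₂ d with Unique-join-meet xs (unique P) mx (consec-∈ˡ d)
                    | Unique-join-meet xs (unique P) my (consec-∈ʳ d)
    ... | refl | refl = ⊥-elim (E-irrefl e)

  path-suffix : ∀ (xs : List V) s ys → InducedPath (xs ++ s ∷ ys) → InducedPath (s ∷ ys)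
  path-suffix xs s ys P = record
    { unique      = Unique-++⁻ʳ xs (unique P)
    ; edge⇒consec = edge⇒consec′
    ; consec⇒edge = λ c → consec⇒edge P (consec-++⁺ʳ xs c) }
    where
    edge⇒consec′ : ∀ {x y} → x ∈ s ∷ ys → y ∈ s ∷ ys → E G x y → Consec (s ∷ ys) x y
    edge⇒consec′ mx my e with consec-join⁻ xs (edge⇒consec P (∈-++⁺ʳ xs mx) (∈-++⁺ʳ xs my) e)
    ... | inj₂ d = d
    ... | inj₁ d with Unique-join-meet xs (unique P) (consec-∈ˡ d) mx
                    | Unique-join-meet xs (unique P) (consec-∈ʳ d) my
    ... | refl | refl = ⊥-elim (E-irrefl e)

  path-reverse : ∀ {L} → InducedPath L → InducedPath (reverse L)
  path-reverse P = record
    { unique      = Unique-reverse (unique P)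
    ; edge⇒consec = λ mx my e → consec-reverse⁺ (edge⇒consec P (reverse⁻ mx) (reverse⁻ my) e)
    ; consec⇒edge = λ c → consec⇒edge P (consec-reverse⁻ c) }

  path-reverse-∷ʳ : ∀ {x L t} → InducedPath (x ∷ L ∷ʳ t) → InducedPath (t ∷ reverse L ∷ʳ x)
  path-reverse-∷ʳ {x} {L} {t} P = subst InducedPath (reverse-∷-∷ʳ x L t) (path-reverse P)

  Apart : List V → List V → Set
  Apart A B = ∀ {v w} → v ∈ A → w ∈ B → v ≢ w × ¬ E G v w

  apart-mono : ∀ {A A′ B B′} → (∀ {v} → v ∈ A′ → v ∈ A) → (∀ {v} → v ∈ B′ → v ∈ B) → Apart A B → Apart A′ B′
  apart-mono A′⊆A B′⊆B sAB mv mw = sAB (A′⊆A mv) (B′⊆B mw)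

  apart-∷ : ∀ {x A B} → Apart [ x ] B → Apart A B → Apart (x ∷ A) B
  apart-∷ sx sA (here refl) = sx (here refl)
  apart-∷ sx sA (there m)   = sA m

  apart-sym : ∀ {A B} → Apart A B → Apart B A
  apart-sym sAB mv mw = let v≢w , v≁w = sAB mw mv in (λ p → v≢w (sym p)) , (λ e → v≁w (E-sym e))

  path-separated : ∀ (xs : List V) s ys → InducedPath (xs ++ s ∷ ys) → Apart xs ys
  path-separated xs s ys P {v} {w} mv mw = distinct , non-adjacent
    where
    U : Unique (xs ++ s ∷ ys)
    U = unique P
    distinct : v ≢ w
    distinct refl = Unique-++-disjoint xs U mv (there mw)
    non-adjacent : ¬ E G v w
    non-adjacent e with consec-join⁻ xs (edge⇒consec P (∈-++⁺ˡ mv) (∈-++⁺ʳ xs (there mw)) e)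
    ... | inj₁ d with ∈-++⁻ xs (consec-∈ʳ d)
    ... | inj₁ p        = Unique-++-disjoint xs U p (there mw)
    ... | inj₂ (here refl) = Unique[x∷xs]⇒x∉xs (Unique-++⁻ʳ xs U) mw
    non-adjacent e | inj₂ d with consec-∈ˡ d
    ... | here refl = Unique-++-disjoint xs U mv (here refl)
    ... | there p   = Unique-++-disjoint xs U mv (there p)

  path-junction : ∀ (xs : List V) s t ys → InducedPath (xs ++ s ∷ t ∷ ys) →
                  ∀ {v w} → v ∈ xs ∷ʳ s → w ∈ t ∷ ys → E G v w → v ≡ s × w ≡ t
  path-junction xs s t ys P {v} {w} mv mw e
    with consec-join⁻ xs (edge⇒consec P (join-mem⁺ˡ xs mv) (∈-++⁺ʳ xs (there mw)) e)
  ... | inj₁ d with ∈-++⁻ xs (consec-∈ʳ d)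
  ... | inj₁ p           = ⊥-elim (Unique-++-disjoint xs (unique P) p (there mw))
  ... | inj₂ (here refl) = ⊥-elim (Unique[x∷xs]⇒x∉xs (Unique-++⁻ʳ xs (unique P)) mw)
  path-junction xs s t ys P mv mw e | inj₂ d with Unique-join-meet xs (unique P) mv (consec-∈ˡ d)
  ... | refl = refl , consec-head (Unique-++⁻ʳ xs (unique P)) d

  path-ends-nonadjacent : ∀ {a c m} M → InducedPath (a ∷ m ∷ M ∷ʳ c) → ¬ E G a c
  path-ends-nonadjacent {a} {c} {m} M P e
    with consec-head (unique P) (edge⇒consec P (here refl) (there (∈-++⁺ʳ (m ∷ M) (here refl))) e)
  ... | refl = Unique[x∷xs]⇒x∉xs (Unique-tail (unique P)) (∈-++⁺ʳ M (here refl))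

module InducedCycles {n : ℕ} (G : Graph n) where
  open InducedPaths G

  CycConsec : List V → V → V → Set
  CycConsec []       x y = ⊥
  CycConsec (z ∷ zs) x y = Consec (z ∷ zs ∷ʳ z) x y

  record InducedCycle (Z : List V) : Set where
    field
      cycle-unique    : Unique Z
      edge⇒cyc-consec : ∀ {x y} → x ∈ Z → y ∈ Z → E G x y → CycConsec Z x y
      cyc-consec⇒edge : ∀ {x y} → CycConsec Z x y → E G x y
  open InducedCycle public

  cyc-consec-split : ∀ s (X : List V) t Y {x y} → CycConsec (s ∷ X ++ t ∷ Y) x y →
                     Consec (s ∷ X ∷ʳ t) x y ⊎ Consec (t ∷ Y ∷ʳ s) x y
  cyc-consec-split s X t Y c rewrite ++-assoc X (t ∷ Y) [ s ] = consec-join⁻ (s ∷ X) c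

  cyc-consec-arc₁ : ∀ s (X : List V) t Y {x y} → Consec (s ∷ X ∷ʳ t) x y → CycConsec (s ∷ X ++ t ∷ Y) x y
  cyc-consec-arc₁ s X t Y c rewrite ++-assoc X (t ∷ Y) [ s ] = consec-join⁺ˡ (s ∷ X) c

  cyc-consec-arc₂ : ∀ s (X : List V) t Y {x y} → Consec (t ∷ Y ∷ʳ s) x y → CycConsec (s ∷ X ++ t ∷ Y) x y
  cyc-consec-arc₂ s X t Y c rewrite ++-assoc X (t ∷ Y) [ s ] = consec-++⁺ʳ (s ∷ X) c

  cyc-consec-rotate : ∀ (A B : List V) {x y} → CycConsec (A ++ B) x y → CycConsec (B ++ A) x y
  cyc-consec-rotate []      B c rewrite ++-identityʳ B = c
  cyc-consec-rotate (a ∷ A) [] c rewrite ++-identityʳ A = c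
  cyc-consec-rotate (a ∷ A) (b ∷ B) c with cyc-consec-split a A b B c
  ... | inj₁ d = cyc-consec-arc₂ b B a A d
  ... | inj₂ d = cyc-consec-arc₁ b B a A d

  cycle-rotate : ∀ (A B : List V) → InducedCycle (A ++ B) → InducedCycle (B ++ A)
  cycle-rotate A B H = record
    { cycle-unique    = ++⁺ (Unique-++⁻ʳ A U) (Unique-++⁻ˡ A U) (λ (m₁ , m₂) → Unique-++-disjoint A U m₂ m₁)
    ; edge⇒cyc-consec = λ mx my e → cyc-consec-rotate A B (edge⇒cyc-consec H (∈-rotate A mx) (∈-rotate A my) e)
    ; cyc-consec⇒edge = λ c → cyc-consec⇒edge H (cyc-consec-rotate B A c) }
    where U = cycle-unique H

  -- The arc has to miss a vertex w of the hole: the whole hole is not a path.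
  cycle-arc : ∀ s (X : List V) t w Y → InducedCycle (s ∷ X ++ t ∷ w ∷ Y) → InducedPath (s ∷ X ∷ʳ t)
  cycle-arc s X t w Y H = record
    { unique      = U₁
    ; edge⇒consec = edge⇒consec′
    ; consec⇒edge = λ c → cyc-consec⇒edge H (cyc-consec-arc₁ s X t (w ∷ Y) c) }
    where
    U₁ : Unique (s ∷ X ∷ʳ t)
    U₁ = Unique-++⁻ˡ (s ∷ X ∷ʳ t) (subst Unique (sym (∷ʳ-++ (s ∷ X) t (w ∷ Y))) (cycle-unique H))
    U₂ : Unique (t ∷ w ∷ Y ∷ʳ s)
    U₂ = Unique-++⁻ˡ (t ∷ w ∷ Y ∷ʳ s)
           (subst Unique (sym (∷ʳ-++ (t ∷ w ∷ Y) s X)) (cycle-unique (cycle-rotate (s ∷ X) (t ∷ w ∷ Y) H)))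
    meet : ∀ {v} → v ∈ s ∷ X ∷ʳ t → v ∈ t ∷ w ∷ Y ∷ʳ s → v ≡ s ⊎ v ≡ t
    meet m₁ m₂ with ∈-++⁻ (t ∷ w ∷ Y) m₂
    ... | inj₂ (here p) = inj₁ p
    ... | inj₁ p        = inj₂ (Unique-join-meet (s ∷ X) (cycle-unique H) m₁ p)
    s-not-next-to-t : ∀ {v} → Consec (t ∷ w ∷ Y ∷ʳ s) t v → v ≢ s
    s-not-next-to-t d refl with consec-head U₂ d
    ... | refl = Unique[x∷xs]⇒x∉xs (Unique-tail U₂) (∈-++⁺ʳ Y (here refl))
    mem-join : ∀ {v} → v ∈ s ∷ X ∷ʳ t → v ∈ s ∷ X ++ t ∷ w ∷ Y
    mem-join {v} m = subst (v ∈_) (∷ʳ-++ (s ∷ X) t (w ∷ Y)) (∈-++⁺ˡ m)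
    edge⇒consec′ : ∀ {x y} → x ∈ s ∷ X ∷ʳ t → y ∈ s ∷ X ∷ʳ t → E G x y → Consec (s ∷ X ∷ʳ t) x y
    edge⇒consec′ mx my e with cyc-consec-split s X t (w ∷ Y) (edge⇒cyc-consec H (mem-join mx) (mem-join my) e)
    ... | inj₁ d = d
    ... | inj₂ d with meet mx (consec-∈ˡ d) | meet my (consec-∈ʳ d)
    ... | inj₁ refl | inj₁ refl = ⊥-elim (E-irrefl e)
    ... | inj₂ refl | inj₂ refl = ⊥-elim (E-irrefl e)
    ... | inj₁ refl | inj₂ refl = ⊥-elim (s-not-next-to-t (consec-sym d) refl)
    ... | inj₂ refl | inj₁ refl = ⊥-elim (s-not-next-to-t d refl)

  cycle-complement : ∀ s w (W : List V) t R → InducedCycle (s ∷ (w ∷ W) ++ t ∷ R) → InducedPath (t ∷ R ∷ʳ s)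
  cycle-complement s w W t R H = cycle-arc t R s w W (cycle-rotate (s ∷ w ∷ W) (t ∷ R) H)

  ∈-complement : ∀ {s w} {W : List V} {t R v} → v ∈ t ∷ R ∷ʳ s → v ∈ s ∷ (w ∷ W) ++ t ∷ R
  ∈-complement {s} {w} {W} {t} {R} m with ∈-++⁻ (t ∷ R) m
  ... | inj₁ p           = ∈-++⁺ʳ (s ∷ w ∷ W) p
  ... | inj₂ (here refl) = here refl

  module ThreeArcs (a : V) (Xa : List V) (b : V) (Xb : List V) (c : V) (Xc : List V) where

    arc-split : ∀ {x y} → CycConsec (a ∷ Xa ++ b ∷ Xb ++ c ∷ Xc) x y →
                Consec (a ∷ Xa ∷ʳ b) x y ⊎ Consec (b ∷ Xb ∷ʳ c) x y ⊎ Consec (c ∷ Xc ∷ʳ a) x y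
    arc-split d with cyc-consec-split a Xa b (Xb ++ c ∷ Xc) d
    ... | inj₁ e = inj₁ e
    ... | inj₂ e rewrite ++-assoc Xb (c ∷ Xc) [ a ] with consec-join⁻ (b ∷ Xb) e
    ... | inj₁ f = inj₂ (inj₁ f)
    ... | inj₂ f = inj₂ (inj₂ f)

    arc₁ : ∀ {x y} → Consec (a ∷ Xa ∷ʳ b) x y → CycConsec (a ∷ Xa ++ b ∷ Xb ++ c ∷ Xc) x y
    arc₁ = cyc-consec-arc₁ a Xa b (Xb ++ c ∷ Xc)

    arc₂ : ∀ {x y} → Consec (b ∷ Xb ∷ʳ c) x y → CycConsec (a ∷ Xa ++ b ∷ Xb ++ c ∷ Xc) x y
    arc₂ d = cyc-consec-arc₂ a Xa b (Xb ++ c ∷ Xc)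
               (subst (λ l → Consec (b ∷ l) _ _) (sym (++-assoc Xb (c ∷ Xc) [ a ])) (consec-join⁺ˡ (b ∷ Xb) d))

    arc₃ : ∀ {x y} → Consec (c ∷ Xc ∷ʳ a) x y → CycConsec (a ∷ Xa ++ b ∷ Xb ++ c ∷ Xc) x y
    arc₃ d = cyc-consec-arc₂ a Xa b (Xb ++ c ∷ Xc)
               (subst (λ l → Consec (b ∷ l) _ _) (sym (++-assoc Xb (c ∷ Xc) [ a ])) (consec-++⁺ʳ (b ∷ Xb) d))

  module FourArcs (a : V) (X₁ : List V) (b : V) (X₂ : List V) (c : V) (X₃ : List V) (d : V) (X₄ : List V) where
    private module T = ThreeArcs a X₁ b X₂ c (X₃ ++ d ∷ X₄)

    arc-split : ∀ {x y} → CycConsec (a ∷ X₁ ++ b ∷ X₂ ++ c ∷ X₃ ++ d ∷ X₄) x y →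
                Consec (a ∷ X₁ ∷ʳ b) x y ⊎ Consec (b ∷ X₂ ∷ʳ c) x y ⊎
                Consec (c ∷ X₃ ∷ʳ d) x y ⊎ Consec (d ∷ X₄ ∷ʳ a) x y
    arc-split e with T.arc-split e
    ... | inj₁ f = inj₁ f
    ... | inj₂ (inj₁ f) = inj₂ (inj₁ f)
    ... | inj₂ (inj₂ f) rewrite ++-assoc X₃ (d ∷ X₄) [ a ] with consec-join⁻ (c ∷ X₃) f
    ... | inj₁ g = inj₂ (inj₂ (inj₁ g))
    ... | inj₂ g = inj₂ (inj₂ (inj₂ g))

    arc₁ : ∀ {x y} → Consec (a ∷ X₁ ∷ʳ b) x y → CycConsec (a ∷ X₁ ++ b ∷ X₂ ++ c ∷ X₃ ++ d ∷ X₄) x y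
    arc₁ = T.arc₁

    arc₂ : ∀ {x y} → Consec (b ∷ X₂ ∷ʳ c) x y → CycConsec (a ∷ X₁ ++ b ∷ X₂ ++ c ∷ X₃ ++ d ∷ X₄) x y
    arc₂ = T.arc₂

    arc₃ : ∀ {x y} → Consec (c ∷ X₃ ∷ʳ d) x y → CycConsec (a ∷ X₁ ++ b ∷ X₂ ++ c ∷ X₃ ++ d ∷ X₄) x y
    arc₃ f = T.arc₃ (subst (λ l → Consec (c ∷ l) _ _) (sym (++-assoc X₃ (d ∷ X₄) [ a ])) (consec-join⁺ˡ (c ∷ X₃) f))

    arc₄ : ∀ {x y} → Consec (d ∷ X₄ ∷ʳ a) x y → CycConsec (a ∷ X₁ ++ b ∷ X₂ ++ c ∷ X₃ ++ d ∷ X₄) x y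
    arc₄ f = T.arc₃ (subst (λ l → Consec (c ∷ l) _ _) (sym (++-assoc X₃ (d ∷ X₄) [ a ])) (consec-++⁺ʳ (c ∷ X₃) f))

  private
    rotate₄-≡ : ∀ a (X₁ : List V) b X₂ c X₃ d X₄ →
                (b ∷ X₂ ++ c ∷ X₃ ++ d ∷ X₄) ++ a ∷ X₁ ≡ b ∷ X₂ ++ c ∷ X₃ ++ d ∷ X₄ ++ a ∷ X₁
    rotate₄-≡ a X₁ b X₂ c X₃ d X₄
      rewrite ++-assoc X₂ (c ∷ X₃ ++ d ∷ X₄) (a ∷ X₁) | ++-assoc X₃ (d ∷ X₄) (a ∷ X₁) = refl

  cycle-rotate₄ : ∀ {a} {X₁ : List V} {b X₂ c X₃ d X₄} → InducedCycle (a ∷ X₁ ++ b ∷ X₂ ++ c ∷ X₃ ++ d ∷ X₄) →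
                  InducedCycle (b ∷ X₂ ++ c ∷ X₃ ++ d ∷ X₄ ++ a ∷ X₁)
  cycle-rotate₄ {a} {X₁} {b} {X₂} {c} {X₃} {d} {X₄} H =
    subst InducedCycle (rotate₄-≡ a X₁ b X₂ c X₃ d X₄) (cycle-rotate (a ∷ X₁) (b ∷ X₂ ++ c ∷ X₃ ++ d ∷ X₄) H)

  ∈-rotate₄ : ∀ {a} {X₁ : List V} {b X₂ c X₃ d X₄ v} → v ∈ b ∷ X₂ ++ c ∷ X₃ ++ d ∷ X₄ ++ a ∷ X₁ →
              v ∈ a ∷ X₁ ++ b ∷ X₂ ++ c ∷ X₃ ++ d ∷ X₄
  ∈-rotate₄ {a} {X₁} {b} {X₂} {c} {X₃} {d} {X₄} {v} m =
    ∈-rotate (a ∷ X₁) (subst (v ∈_) (sym (rotate₄-≡ a X₁ b X₂ c X₃ d X₄)) m)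

  cycle-opposite-nonadjacent : ∀ {a b c d} (X₁ X₂ X₃ X₄ : List V) →
                               InducedCycle (a ∷ X₁ ++ b ∷ X₂ ++ c ∷ X₃ ++ d ∷ X₄) → ¬ E G a c
  cycle-opposite-nonadjacent {a} {b} {c} {d} X₁ X₂ X₃ X₄ H
    with ++-∷-nonempty X₁ b X₂ | ++-∷-nonempty X₃ d X₄
  ... | m , M , eq₁ | w , W , eq₃ = path-ends-nonadjacent M (cycle-arc a (m ∷ M) c w W H′)
    where
    H′ : InducedCycle (a ∷ (m ∷ M) ++ c ∷ w ∷ W)
    H′ = subst InducedCycle
           (cong (a ∷_) (trans (sym (++-assoc X₁ (b ∷ X₂) (c ∷ X₃ ++ d ∷ X₄)))
                               (cong₂ (λ l r → l ++ c ∷ r) eq₁ eq₃))) H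

module _ {A : Set} where

  -- Edge e of K4 joins k4src e to k4tgt e; in order: 01, 02, 03, 12, 13, 23.
  k4-path : (Fin 4 → A) → (Fin 6 → List A) → Fin 6 → List A
  k4-path br int e = br (k4src e) ∷ int e ∷ʳ br (k4tgt e)

  k4-vertices : (Fin 4 → A) → (Fin 6 → List A) → List A
  k4-vertices br int = map br allFin4 ++ concat (map int allFin6)

  k4-vertices-↭ : ∀ (br : Fin 4 → A) {int} (int′ : Fin 6 → List A) → (∀ e → int e ↭ int′ e) →
                  k4-vertices br int ↭ k4-vertices br int′
  k4-vertices-↭ br int′ p =
    ↭-++⁺ˡ (map br allFin4) (↭-++⁺ (p 0F) (↭-++⁺ (p 1F) (↭-++⁺ (p 2F) (↭-++⁺ (p 3F) (↭-++⁺ (p 4F) (↭-++⁺ (p 5F) ↭-refl))))))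

  OnSomePath : (Fin 6 → List A) → A → A → Set
  OnSomePath P u v = ∃ λ e → Consec (P e) u v

  on-some-path-sym : ∀ {P : Fin 6 → List A} {u v} → OnSomePath P u v → OnSomePath P v u
  on-some-path-sym (e , c) = e , consec-sym c

module Recognition {n : ℕ} (G : Graph n) where
  open InducedPaths G

  edges-on-paths-++ : ∀ {P} T Z →
    (∀ {u v} → u ∈ T → v ∈ T → E G u v → OnSomePath P u v) →
    (∀ {u v} → u ∈ T → v ∈ Z → E G u v → OnSomePath P u v) →
    (∀ {u v} → u ∈ Z → v ∈ Z → E G u v → OnSomePath P u v) →
    ∀ {u v} → u ∈ T ++ Z → v ∈ T ++ Z → E G u v → OnSomePath P u v
  edges-on-paths-++ T Z TT TZ ZZ mu mv e with ∈-++⁻ T mu | ∈-++⁻ T mv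
  ... | inj₁ p | inj₁ q = TT p q e
  ... | inj₁ p | inj₂ q = TZ p q e
  ... | inj₂ p | inj₁ q = on-some-path-sym (TZ q p (E-sym e))
  ... | inj₂ p | inj₂ q = ZZ p q e

  -- The vertices may be listed in any order (up to ↭), so that each configuration can list
  -- them as its own pieces followed by the hole.
  record InducedK4Subdivision : Set where
    field
      branch          : Fin 4 → V
      internal        : Fin 6 → List V
      vertices        : List V
      vertices-↭      : k4-vertices branch internal ↭ vertices
      vertices-unique : Unique vertices
      edge⇒on-path    : ∀ {u v} → u ∈ vertices → v ∈ vertices → E G u v →
                        OnSomePath (k4-path branch internal) u v
      on-path⇒edge    : ∀ e {u v} → Consec (k4-path branch internal e) u v → E G u v

  private
    ∈-allFin6 : ∀ e → e ∈ allFin6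
    ∈-allFin6 0F = here refl
    ∈-allFin6 1F = there (here refl)
    ∈-allFin6 2F = there (there (here refl))
    ∈-allFin6 3F = there (there (there (here refl)))
    ∈-allFin6 4F = there (there (there (there (here refl))))
    ∈-allFin6 5F = there (there (there (there (there (here refl)))))

    ∈-allFin4 : ∀ k → k ∈ allFin4
    ∈-allFin4 0F = here refl
    ∈-allFin4 1F = there (here refl)
    ∈-allFin4 2F = there (there (here refl))
    ∈-allFin4 3F = there (there (there (here refl)))

  -- The subgraph induced on the listed vertices, indexed by their positions.
  InducedK4Subdivision⇒HasISK4 : InducedK4Subdivision → HasISK4 G
  InducedK4Subdivision⇒HasISK4 S = length L , H , subdivision , f , f-inj , λ _ _ → refl
    where
    open InducedK4Subdivision S
    L : List V
    L = k4-vertices branch internal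
    f : Fin (length L) → V
    f = lookup L
    L-unique : Unique L
    L-unique = Unique-resp-↭ (setoid V) (↭⇒↭ₛ (↭-sym vertices-↭)) vertices-unique
    f-inj : ∀ {i j} → f i ≡ f j → i ≡ j
    f-inj = lookup-injective L-unique
    H : Graph (length L)
    H = record { adj = λ i j → adj G (f i) (f j) ; sym = λ i j → Graph.sym G (f i) (f j) ; irrefl = λ i → Graph.irrefl G (f i) }

    position : ∀ {x} → x ∈ L → Fin (length L)
    position = index
    f-position : ∀ {x} (p : x ∈ L) → f (position p) ≡ x
    f-position p = sym (lookup-index p)
    positions : (xs : List V) → (∀ {x} → x ∈ xs → x ∈ L) → List (Fin (length L))
    positions xs sub = mapWith∈ xs (λ m → position (sub m))
    map-positions : ∀ xs (sub : ∀ {x} → x ∈ xs → x ∈ L) → map f (positions xs sub) ≡ xs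
    map-positions xs sub = trans (map-mapWith∈ xs _ f)
                                 (trans (mapWith∈-cong xs _ _ (λ m → f-position (sub m))) (mapWith∈-id xs))

    branch∈L : ∀ k → branch k ∈ L
    branch∈L k = ∈-++⁺ˡ (∈-map⁺ branch (∈-allFin4 k))
    internal⊆L : ∀ e {x} → x ∈ internal e → x ∈ L
    internal⊆L e p = ∈-++⁺ʳ (map branch allFin4) (∈-concat⁺′ p (∈-map⁺ internal (∈-allFin6 e)))

    branch′ : Fin 4 → Fin (length L)
    branch′ k = position (branch∈L k)
    internal′ : Fin 6 → List (Fin (length L))
    internal′ e = positions (internal e) (internal⊆L e)

    map-vertices : map f (k4-vertices branch′ internal′) ≡ L
    map-vertices = trans (map-++ f (map branch′ allFin4) (concat (map internal′ allFin6)))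
                         (cong₂ _++_ on-branches on-internals)
      where
      on-branches : map f (map branch′ allFin4) ≡ map branch allFin4
      on-branches = trans (sym (map-∘ {g = f} {f = branch′} allFin4)) (map-cong (λ k → f-position (branch∈L k)) allFin4)
      on-internals : map f (concat (map internal′ allFin6)) ≡ concat (map internal allFin6)
      on-internals = trans (sym (concat-map (map internal′ allFin6)))
                           (cong concat (trans (sym (map-∘ {g = map f} {f = internal′} allFin6))
                                               (map-cong (λ e → map-positions (internal e) (internal⊆L e)) allFin6)))

    map-path : ∀ e → map f (k4-path branch′ internal′ e) ≡ k4-path branch internal e
    map-path e rewrite map-++ f (internal′ e) [ branch′ (k4tgt e) ]
                     | map-positions (internal e) (internal⊆L e)
                     | f-position (branch∈L (k4src e)) | f-position (branch∈L (k4tgt e)) = refl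

    subdivision : IsSubdivisionOfK4 H
    subdivision = record
      { branch       = branch′
      ; internal     = internal′
      ; verts-unique = map⁻ (subst Unique (sym map-vertices) L-unique)
      ; verts-cover  = cover
      ; edges        = λ u v → mk⇔ (to u v) (from u v) }
      where
      cover : ∀ v → v ∈ k4-vertices branch′ internal′
      cover v with ∈-map⁻ f (subst (f v ∈_) (sym map-vertices) (∈-lookup v))
      ... | w , w∈ , fv≡fw = subst (_∈ _) (sym (f-inj fv≡fw)) w∈
      to : ∀ u v → E G (f u) (f v) → OnSomePath (k4-path branch′ internal′) u v
      to u v e with edge⇒on-path (∈-resp-↭ vertices-↭ (∈-lookup u)) (∈-resp-↭ vertices-↭ (∈-lookup v)) e
      ... | k , c = k , consec-map⁻-injective f f-inj _ (subst (λ l → Consec l (f u) (f v)) (sym (map-path k)) c)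
      from : ∀ u v → (OnSomePath (k4-path branch′ internal′) u v) → E G (f u) (f v)
      from u v (k , c) = on-path⇒edge k (subst (λ l → Consec l (f u) (f v)) (map-path k) (consec-map⁺ f c))

  ¬E⇒adj≡false : ∀ {x y} → ¬ E G x y → adj G x y ≡ false
  ¬E⇒adj≡false = ¬-not

  K33-intro : ∀ {a₁ a₂ a₃ b₁ b₂ b₃ : V} →
    E G a₁ b₁ → E G a₁ b₂ → E G a₁ b₃ → E G a₂ b₁ → E G a₂ b₂ → E G a₂ b₃ →
    E G a₃ b₁ → E G a₃ b₂ → E G a₃ b₃ →
    ¬ E G a₁ a₂ → ¬ E G a₁ a₃ → ¬ E G a₂ a₃ → ¬ E G b₁ b₂ → ¬ E G b₁ b₃ → ¬ E G b₂ b₃ →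
    a₁ ≢ a₂ → a₁ ≢ a₃ → a₂ ≢ a₃ → b₁ ≢ b₂ → b₁ ≢ b₃ → b₂ ≢ b₃ → Contains G K33
  K33-intro {a₁} {a₂} {a₃} {b₁} {b₂} {b₃} e₁₁ e₁₂ e₁₃ e₂₁ e₂₂ e₂₃ e₃₁ e₃₂ e₃₃
            n₁₂ n₁₃ n₂₃ m₁₂ m₁₃ m₂₃ d₁₂ d₁₃ d₂₃ d′₁₂ d′₁₃ d′₂₃ =
    lookup vs , lookup-injective vs-unique , same-adj
    where
    vs : List V
    vs = a₁ ∷ a₂ ∷ a₃ ∷ b₁ ∷ b₂ ∷ b₃ ∷ []
    vs-unique : Unique vs
    vs-unique = (d₁₂ ∷ d₁₃ ∷ E⇒≢ e₁₁ ∷ E⇒≢ e₁₂ ∷ E⇒≢ e₁₃ ∷ [])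
              ∷ (d₂₃ ∷ E⇒≢ e₂₁ ∷ E⇒≢ e₂₂ ∷ E⇒≢ e₂₃ ∷ [])
              ∷ (E⇒≢ e₃₁ ∷ E⇒≢ e₃₂ ∷ E⇒≢ e₃₃ ∷ [])
              ∷ (d′₁₂ ∷ d′₁₃ ∷ []) ∷ (d′₂₃ ∷ []) ∷ [] ∷ []
    ¬E-sym : ∀ {x y} → ¬ E G x y → ¬ E G y x
    ¬E-sym ne e = ne (E-sym e)
    same-adj : ∀ u v → adj K33 u v ≡ adj G (lookup vs u) (lookup vs v)
    same-adj 0F 0F = sym (Graph.irrefl G a₁)
    same-adj 0F 1F = sym (¬E⇒adj≡false n₁₂)
    same-adj 0F 2F = sym (¬E⇒adj≡false n₁₃)
    same-adj 0F 3F = sym e₁₁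
    same-adj 0F 4F = sym e₁₂
    same-adj 0F 5F = sym e₁₃
    same-adj 1F 0F = sym (¬E⇒adj≡false (¬E-sym n₁₂))
    same-adj 1F 1F = sym (Graph.irrefl G a₂)
    same-adj 1F 2F = sym (¬E⇒adj≡false n₂₃)
    same-adj 1F 3F = sym e₂₁
    same-adj 1F 4F = sym e₂₂
    same-adj 1F 5F = sym e₂₃
    same-adj 2F 0F = sym (¬E⇒adj≡false (¬E-sym n₁₃))
    same-adj 2F 1F = sym (¬E⇒adj≡false (¬E-sym n₂₃))
    same-adj 2F 2F = sym (Graph.irrefl G a₃)
    same-adj 2F 3F = sym e₃₁
    same-adj 2F 4F = sym e₃₂
    same-adj 2F 5F = sym e₃₃
    same-adj 3F 0F = sym (E-sym e₁₁)
    same-adj 3F 1F = sym (E-sym e₂₁)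
    same-adj 3F 2F = sym (E-sym e₃₁)
    same-adj 3F 3F = sym (Graph.irrefl G b₁)
    same-adj 3F 4F = sym (¬E⇒adj≡false m₁₂)
    same-adj 3F 5F = sym (¬E⇒adj≡false m₁₃)
    same-adj 4F 0F = sym (E-sym e₁₂)
    same-adj 4F 1F = sym (E-sym e₂₂)
    same-adj 4F 2F = sym (E-sym e₃₂)
    same-adj 4F 3F = sym (¬E⇒adj≡false (¬E-sym m₁₂))
    same-adj 4F 4F = sym (Graph.irrefl G b₂)
    same-adj 4F 5F = sym (¬E⇒adj≡false m₂₃)
    same-adj 5F 0F = sym (E-sym e₁₃)
    same-adj 5F 1F = sym (E-sym e₂₃)
    same-adj 5F 2F = sym (E-sym e₃₃)
    same-adj 5F 3F = sym (¬E⇒adj≡false (¬E-sym m₁₃))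
    same-adj 5F 4F = sym (¬E⇒adj≡false (¬E-sym m₂₃))
    same-adj 5F 5F = sym (Graph.irrefl G b₃)

module Configurations {n : ℕ} (G : Graph n) where
  open InducedPaths G
  open InducedCycles G
  open Recognition G
  -- Permutations of vertex lists are normalised by the commutative-monoid solver for (List V, _++_)
  -- up to _↭_, with singletons and the pieces of the configuration as atoms.
  open import Algebra.Solver.CommutativeMonoid (++-commutativeMonoid {A = V}) using (solve; _⊜_; _⊕_; id)

  -- Only the interior L must see Z just at a; the neighbours of x on Z are constrained separately.
  record Leg (Z : List V) (x : V) (L : List V) (a : V) : Set where
    field
      leg-path   : InducedPath (x ∷ L ∷ʳ a)
      leg-off    : ∀ {v} → v ∈ x ∷ L → v ∉ Z
      leg-attach : ∀ {v z} → v ∈ L → z ∈ Z → E G v z → z ≡ a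
  open Leg public

  leg-edge : ∀ {Z x L a u v} → Leg Z x L a → u ∈ x ∷ L → v ∈ x ∷ L → E G u v → Consec (x ∷ L ∷ʳ a) u v
  leg-edge A mu mv e = edge⇒consec (leg-path A) (∈-++⁺ˡ mu) (∈-++⁺ˡ mv) e

  leg-end-edge : ∀ {Z x L a u} → Leg Z x L a → u ∈ x ∷ L → E G u a → Consec (x ∷ L ∷ʳ a) u a
  leg-end-edge {L = L} A mu e = edge⇒consec (leg-path A) (∈-++⁺ˡ mu) (∈-++⁺ʳ (_ ∷ L) (here refl)) e

  leg-cons : ∀ {Z y s L a} → Leg Z s L a → E G y s → y ∉ Z → a ∈ Z → ¬ E G y a → Apart [ y ] L →
             (∀ {z} → z ∈ Z → E G s z → z ≡ a) → Leg Z y (s ∷ L) a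
  leg-cons {Z} {y} {s} {L} {a} S eys y∉Z a∈Z y≁a sy s-attach = record
    { leg-path   = path-cons eys y∉ y≁ (leg-path S)
    ; leg-off    = λ { (here refl) → y∉Z ; (there m) → leg-off S m }
    ; leg-attach = λ { (here refl) → s-attach ; (there m) → leg-attach S m } }
    where
    y∉ : y ∉ s ∷ L ∷ʳ a
    y∉ (here refl) = E-irrefl eys
    y∉ (there m) with ∈-++⁻ L m
    ... | inj₁ p        = proj₁ (sy (here refl) p) refl
    ... | inj₂ (here refl) = y∉Z a∈Z
    y≁ : ∀ {z} → z ∈ L ∷ʳ a → ¬ E G y z
    y≁ m with ∈-++⁻ L m
    ... | inj₁ p        = proj₂ (sy (here refl) p)
    ... | inj₂ (here refl) = y≁a

  tripod⇒ISK4 : ∀ {a} {Xa : List V} {b Xb c Xc x La Lb Lc} →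
    let Z = a ∷ Xa ++ b ∷ Xb ++ c ∷ Xc in
    InducedCycle Z → Leg Z x La a → Leg Z x Lb b → Leg Z x Lc c →
    Apart La Lb → Apart La Lc → Apart Lb Lc →
    (∀ {z} → z ∈ Z → E G x z → z ≡ a ⊎ z ≡ b ⊎ z ≡ c) → HasISK4 G
  tripod⇒ISK4 {a} {Xa} {b} {Xb} {c} {Xc} {x} {La} {Lb} {Lc} H A B C sAB sAC sBC x-attach =
    InducedK4Subdivision⇒HasISK4 (record
      { branch          = br
      ; internal        = int
      ; vertices        = T ++ Z
      ; vertices-↭      = ↭-trans (k4-vertices-↭ br int-unreversed unreverse)
          (solve 10 (λ x a b c la lb lc xa xb xc →
                       (x ⊕ (a ⊕ (b ⊕ (c ⊕ id)))) ⊕ (la ⊕ (lb ⊕ (lc ⊕ (xa ⊕ (xc ⊕ (xb ⊕ id)))))) ⊜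
                       (x ⊕ (la ⊕ (lb ⊕ lc))) ⊕ (a ⊕ (xa ⊕ (b ⊕ (xb ⊕ (c ⊕ xc))))))
                 ↭-refl [ x ] [ a ] [ b ] [ c ] La Lb Lc Xa Xb Xc)
      ; vertices-unique = ++⁺ T-unique (cycle-unique H) (λ (m₁ , m₂) → T-off m₁ m₂)
      ; edge⇒on-path    = edges-on-paths-++ T Z leg-to-leg leg-to-cycle cycle-edge
      ; on-path⇒edge    = on-path⇒edge })
    where
    Z : List V
    Z = a ∷ Xa ++ b ∷ Xb ++ c ∷ Xc
    T : List V
    T = x ∷ La ++ Lb ++ Lc
    open ThreeArcs a Xa b Xb c Xc
    br : Fin 4 → V
    br = λ { 0F → x ; 1F → a ; 2F → b ; 3F → c }
    int : Fin 6 → List V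
    int = λ { 0F → La ; 1F → Lb ; 2F → Lc ; 3F → Xa ; 4F → reverse Xc ; 5F → Xb }
    int-unreversed : Fin 6 → List V
    int-unreversed = λ { 4F → Xc ; e → int e }
    unreverse : ∀ e → int e ↭ int-unreversed e
    unreverse = λ { 0F → ↭-refl ; 1F → ↭-refl ; 2F → ↭-refl ; 3F → ↭-refl ; 4F → ↭-reverse Xc ; 5F → ↭-refl }

    classify-interior : ∀ {v} → v ∈ La ++ Lb ++ Lc → v ∈ La ⊎ v ∈ Lb ⊎ v ∈ Lc
    classify-interior m with ∈-++⁻ La m
    ... | inj₁ p = inj₁ p
    ... | inj₂ q with ∈-++⁻ Lb q
    ... | inj₁ p = inj₂ (inj₁ p)
    ... | inj₂ p = inj₂ (inj₂ p)

    classify : ∀ {v} → v ∈ T → v ≡ x ⊎ v ∈ La ⊎ v ∈ Lb ⊎ v ∈ Lc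
    classify (here p)  = inj₁ p
    classify (there m) = inj₂ (classify-interior m)

    T-off : ∀ {v} → v ∈ T → v ∉ Z
    T-off m with classify m
    ... | inj₁ refl = leg-off A (here refl)
    ... | inj₂ (inj₁ p) = leg-off A (there p)
    ... | inj₂ (inj₂ (inj₁ p)) = leg-off B (there p)
    ... | inj₂ (inj₂ (inj₂ p)) = leg-off C (there p)

    interior-unique : ∀ {L y} → Leg Z x L y → Unique L
    interior-unique {L} P = Unique-tail (Unique-++⁻ˡ (x ∷ L) (unique (leg-path P)))

    T-unique : Unique T
    T-unique = Unique-∷ x∉ (++⁺ (interior-unique A) (++⁺ (interior-unique B) (interior-unique C)
                                     (λ (p , q) → proj₁ (sBC p q) refl))
                                (λ (p , q) → La-Lb∪Lc p (∈-++⁻ Lb q)))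
      where
      La-Lb∪Lc : ∀ {v} → v ∈ La → v ∈ Lb ⊎ v ∈ Lc → ⊥
      La-Lb∪Lc p (inj₁ q) = proj₁ (sAB p q) refl
      La-Lb∪Lc p (inj₂ q) = proj₁ (sAC p q) refl
      x∉ : x ∉ La ++ Lb ++ Lc
      x∉ m with classify-interior m
      ... | inj₁ p = Unique[x∷xs]⇒x∉xs (unique (leg-path A)) (∈-++⁺ˡ p)
      ... | inj₂ (inj₁ p) = Unique[x∷xs]⇒x∉xs (unique (leg-path B)) (∈-++⁺ˡ p)
      ... | inj₂ (inj₂ p) = Unique[x∷xs]⇒x∉xs (unique (leg-path C)) (∈-++⁺ˡ p)

    paths : Fin 6 → List V
    paths = k4-path br int

    cycle-edge : ∀ {u v} → u ∈ Z → v ∈ Z → E G u v → OnSomePath paths u v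
    cycle-edge mu mv e with arc-split (edge⇒cyc-consec H mu mv e)
    ... | inj₁ d = 3F , d
    ... | inj₂ (inj₁ d) = 5F , d
    ... | inj₂ (inj₂ d) = 4F , consec-reverse-∷ʳ⁺ d

    leg-to-cycle : ∀ {u v} → u ∈ T → v ∈ Z → E G u v → OnSomePath paths u v
    leg-to-cycle mu mv e with classify mu
    ... | inj₂ (inj₁ p) with refl ← leg-attach A p mv e = 0F , leg-end-edge A (there p) e
    ... | inj₂ (inj₂ (inj₁ p)) with refl ← leg-attach B p mv e = 1F , leg-end-edge B (there p) e
    ... | inj₂ (inj₂ (inj₂ p)) with refl ← leg-attach C p mv e = 2F , leg-end-edge C (there p) e
    ... | inj₁ refl with x-attach mv e
    ... | inj₁ refl = 0F , leg-end-edge A (here refl) e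
    ... | inj₂ (inj₁ refl) = 1F , leg-end-edge B (here refl) e
    ... | inj₂ (inj₂ refl) = 2F , leg-end-edge C (here refl) e

    leg-to-leg : ∀ {u v} → u ∈ T → v ∈ T → E G u v → OnSomePath paths u v
    leg-to-leg mu mv e with classify mu | classify mv
    ... | inj₁ refl | inj₁ refl = ⊥-elim (E-irrefl e)
    ... | inj₁ refl | inj₂ (inj₁ q) = 0F , leg-edge A (here refl) (there q) e
    ... | inj₁ refl | inj₂ (inj₂ (inj₁ q)) = 1F , leg-edge B (here refl) (there q) e
    ... | inj₁ refl | inj₂ (inj₂ (inj₂ q)) = 2F , leg-edge C (here refl) (there q) e
    ... | inj₂ (inj₁ p) | inj₁ refl = 0F , leg-edge A (there p) (here refl) e
    ... | inj₂ (inj₂ (inj₁ p)) | inj₁ refl = 1F , leg-edge B (there p) (here refl) e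
    ... | inj₂ (inj₂ (inj₂ p)) | inj₁ refl = 2F , leg-edge C (there p) (here refl) e
    ... | inj₂ (inj₁ p) | inj₂ (inj₁ q) = 0F , leg-edge A (there p) (there q) e
    ... | inj₂ (inj₂ (inj₁ p)) | inj₂ (inj₂ (inj₁ q)) = 1F , leg-edge B (there p) (there q) e
    ... | inj₂ (inj₂ (inj₂ p)) | inj₂ (inj₂ (inj₂ q)) = 2F , leg-edge C (there p) (there q) e
    ... | inj₂ (inj₁ p) | inj₂ (inj₂ (inj₁ q)) = ⊥-elim (proj₂ (sAB p q) e)
    ... | inj₂ (inj₁ p) | inj₂ (inj₂ (inj₂ q)) = ⊥-elim (proj₂ (sAC p q) e)
    ... | inj₂ (inj₂ (inj₁ p)) | inj₂ (inj₂ (inj₂ q)) = ⊥-elim (proj₂ (sBC p q) e)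
    ... | inj₂ (inj₂ (inj₁ p)) | inj₂ (inj₁ q) = ⊥-elim (proj₂ (sAB q p) (E-sym e))
    ... | inj₂ (inj₂ (inj₂ p)) | inj₂ (inj₁ q) = ⊥-elim (proj₂ (sAC q p) (E-sym e))
    ... | inj₂ (inj₂ (inj₂ p)) | inj₂ (inj₂ (inj₁ q)) = ⊥-elim (proj₂ (sBC q p) (E-sym e))

    on-path⇒edge : ∀ e {u v} → Consec (paths e) u v → E G u v
    on-path⇒edge 0F d = consec⇒edge (leg-path A) d
    on-path⇒edge 1F d = consec⇒edge (leg-path B) d
    on-path⇒edge 2F d = consec⇒edge (leg-path C) d
    on-path⇒edge 3F d = cyc-consec⇒edge H (arc₁ d)
    on-path⇒edge 4F d = cyc-consec⇒edge H (arc₃ (consec-reverse-∷ʳ⁻ c Xc a d))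
    on-path⇒edge 5F d = cyc-consec⇒edge H (arc₂ d)

  LinkedOnlyAt : V → List V → V → List V → Set
  LinkedOnlyAt x L y M = ∀ {v u} → v ∈ x ∷ L → u ∈ y ∷ M → v ≢ u × (E G v u → v ≡ x × u ≡ y)

  linked-if-apart : ∀ {x L y M} → x ≢ y → Apart [ x ] M → Apart L (y ∷ M) → LinkedOnlyAt x L y M
  linked-if-apart x≢y sx sL (here refl) (here refl) = x≢y , λ _ → refl , refl
  linked-if-apart x≢y sx sL (here refl) (there m)   = proj₁ (sx (here refl) m) , λ e → ⊥-elim (proj₂ (sx (here refl) m) e)
  linked-if-apart x≢y sx sL (there l)   u           = proj₁ (sL l u) , λ e → ⊥-elim (proj₂ (sL l u) e)

  path-linked : ∀ K s t K′ → InducedPath (K ++ s ∷ t ∷ K′) →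
                ∀ {L M} → (∀ {v} → v ∈ L → v ∈ K) → (∀ {v} → v ∈ M → v ∈ K′) → LinkedOnlyAt s L t M
  path-linked K s t K′ P L⊆K M⊆K′ {v} {u} mv mu = distinct , path-junction K s t K′ P (before mv) (after mu)
    where
    before : ∀ {v} → v ∈ s ∷ _ → v ∈ K ∷ʳ s
    before (here refl) = ∈-++⁺ʳ K (here refl)
    before (there m)   = ∈-++⁺ˡ (L⊆K m)
    after : ∀ {v} → v ∈ t ∷ _ → v ∈ t ∷ K′
    after (here refl) = here refl
    after (there m)   = there (M⊆K′ m)
    distinct : v ≢ u
    distinct = λ v≡u → Unique-++-disjoint (K ∷ʳ s) (subst Unique (sym (∷ʳ-++ K s (t ∷ K′))) (unique P))
                         (before mv) (subst (_∈ _) (sym v≡u) (after mu))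

  prism⇒ISK4 : ∀ {a} {Xa : List V} {b w Xb c Xc x y z La Lb Lc} →
    let Z = a ∷ Xa ++ b ∷ (w ∷ Xb) ++ c ∷ Xc in
    InducedCycle Z → Leg Z x La a → Leg Z y Lb b → Leg Z z Lc c →
    E G x y → E G x z → E G y z →
    LinkedOnlyAt x La y Lb → LinkedOnlyAt x La z Lc → LinkedOnlyAt y Lb z Lc →
    (∀ {v} → v ∈ Z → E G x v → v ≡ a) → (∀ {v} → v ∈ Z → E G y v → v ≡ b) → (∀ {v} → v ∈ Z → E G z v → v ≡ c) →
    HasISK4 G
  prism⇒ISK4 {a} {Xa} {b} {w} {Xb} {c} {Xc} {x} {y} {z} {La} {Lb} {Lc} H A B C exy exz eyz lAB lAC lBC x-att y-att z-att =
    InducedK4Subdivision⇒HasISK4 (record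
      { branch          = br
      ; internal        = int
      ; vertices        = T ++ K
      ; vertices-↭      = ↭-trans (k4-vertices-↭ br int-unreversed unreverse)
          (solve 11 (λ a x y z b c la lb lc xa xc →
                       (a ⊕ (x ⊕ (y ⊕ (z ⊕ id)))) ⊕ (la ⊕ ((xa ⊕ (b ⊕ lb)) ⊕ ((xc ⊕ (c ⊕ lc)) ⊕ (id ⊕ (id ⊕ (id ⊕ id)))))) ⊜
                       ((x ⊕ la) ⊕ ((y ⊕ lb) ⊕ (z ⊕ lc))) ⊕ (c ⊕ ((xc ⊕ (a ⊕ xa)) ⊕ b)))
                 ↭-refl [ a ] [ x ] [ y ] [ z ] [ b ] [ c ] La Lb Lc Xa Xc)
      ; vertices-unique = ++⁺ T-unique (unique K-path) (λ (m₁ , m₂) → T-off m₁ (K⊆Z m₂))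
      ; edge⇒on-path    = edges-on-paths-++ T K leg-to-leg leg-to-cycle cycle-edge
      ; on-path⇒edge    = on-path⇒edge })
    where
    Z : List V
    Z = a ∷ Xa ++ b ∷ (w ∷ Xb) ++ c ∷ Xc
    K : List V
    K = c ∷ (Xc ++ a ∷ Xa) ∷ʳ b
    T : List V
    T = (x ∷ La) ++ (y ∷ Lb) ++ (z ∷ Lc)
    br : Fin 4 → V
    br = λ { 0F → a ; 1F → x ; 2F → y ; 3F → z }
    int : Fin 6 → List V
    int = λ { 0F → reverse La ; 1F → Xa ++ b ∷ reverse Lb ; 2F → reverse Xc ++ c ∷ reverse Lc ; _ → [] }
    int-unreversed : Fin 6 → List V
    int-unreversed = λ { 0F → La ; 1F → Xa ++ b ∷ Lb ; 2F → Xc ++ c ∷ Lc ; _ → [] }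
    unreverse : ∀ e → int e ↭ int-unreversed e
    unreverse = λ { 0F → ↭-reverse La
                  ; 1F → ↭-++⁺ˡ Xa (prep b (↭-reverse Lb))
                  ; 2F → ↭-++⁺ (↭-reverse Xc) (prep c (↭-reverse Lc))
                  ; 3F → ↭-refl ; 4F → ↭-refl ; 5F → ↭-refl }

    from-b≡ : (b ∷ (w ∷ Xb) ++ c ∷ Xc) ++ a ∷ Xa ≡ b ∷ (w ∷ Xb) ++ c ∷ (Xc ++ a ∷ Xa)
    from-b≡ = cong (b ∷_) (++-assoc (w ∷ Xb) (c ∷ Xc) (a ∷ Xa))
    K-path : InducedPath K
    K-path = cycle-complement b w Xb c (Xc ++ a ∷ Xa) (subst InducedCycle from-b≡ (cycle-rotate (a ∷ Xa) _ H))
    K⊆Z : ∀ {v} → v ∈ K → v ∈ Z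
    K⊆Z {v} m = ∈-rotate (a ∷ Xa) (subst (v ∈_) (sym from-b≡) (∈-complement m))

    classify : ∀ {v} → v ∈ T → v ∈ x ∷ La ⊎ v ∈ y ∷ Lb ⊎ v ∈ z ∷ Lc
    classify m with ∈-++⁻ (x ∷ La) m
    ... | inj₁ p = inj₁ p
    ... | inj₂ q with ∈-++⁻ (y ∷ Lb) q
    ... | inj₁ p = inj₂ (inj₁ p)
    ... | inj₂ p = inj₂ (inj₂ p)

    T-off : ∀ {v} → v ∈ T → v ∉ Z
    T-off m with classify m
    ... | inj₁ p = leg-off A p
    ... | inj₂ (inj₁ p) = leg-off B p
    ... | inj₂ (inj₂ p) = leg-off C p

    T-unique : Unique T
    T-unique = ++⁺ (Unique-++⁻ˡ (x ∷ La) (unique (leg-path A)))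
                   (++⁺ (Unique-++⁻ˡ (y ∷ Lb) (unique (leg-path B))) (Unique-++⁻ˡ (z ∷ Lc) (unique (leg-path C)))
                        (λ (p , q) → proj₁ (lBC p q) refl))
                   (λ (p , q) → A-B∪C p (∈-++⁻ (y ∷ Lb) q))
      where
      A-B∪C : ∀ {v} → v ∈ x ∷ La → v ∈ y ∷ Lb ⊎ v ∈ z ∷ Lc → ⊥
      A-B∪C p (inj₁ q) = proj₁ (lAB p q) refl
      A-B∪C p (inj₂ q) = proj₁ (lAC p q) refl

    paths : Fin 6 → List V
    paths = k4-path br int

    cycle-edge : ∀ {u v} → u ∈ K → v ∈ K → E G u v → OnSomePath paths u v
    cycle-edge mu mv e with consec-via⁻ c Xc a Xa b (edge⇒consec K-path mu mv e)
    ... | inj₁ d = 2F , consec-via⁺ a (reverse Xc) c (reverse Lc) z (inj₁ (consec-reverse-∷ʳ⁺ d))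
    ... | inj₂ d = 1F , consec-via⁺ a Xa b (reverse Lb) y (inj₁ d)

    end-attach : ∀ {s L t} → Leg Z s L t → (∀ {z} → z ∈ Z → E G s z → z ≡ t) →
                 ∀ {u v} → u ∈ s ∷ L → v ∈ Z → E G u v → v ≡ t
    end-attach L s-att (here refl) mv e = s-att mv e
    end-attach L s-att (there p)   mv e = leg-attach L p mv e

    leg-to-cycle : ∀ {u v} → u ∈ T → v ∈ K → E G u v → OnSomePath paths u v
    leg-to-cycle mu mv e with classify mu
    ... | inj₁ p with refl ← end-attach A x-att p (K⊆Z mv) e =
      0F , consec-reverse-∷ʳ⁺ (leg-end-edge A p e)
    ... | inj₂ (inj₁ p) with refl ← end-attach B y-att p (K⊆Z mv) e =
      1F , consec-via⁺ a Xa b (reverse Lb) y (inj₂ (consec-reverse-∷ʳ⁺ (leg-end-edge B p e)))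
    ... | inj₂ (inj₂ p) with refl ← end-attach C z-att p (K⊆Z mv) e =
      2F , consec-via⁺ a (reverse Xc) c (reverse Lc) z (inj₂ (consec-reverse-∷ʳ⁺ (leg-end-edge C p e)))

    leg-to-leg : ∀ {u v} → u ∈ T → v ∈ T → E G u v → OnSomePath paths u v
    leg-to-leg mu mv e with classify mu | classify mv
    ... | inj₁ p | inj₁ q = 0F , consec-reverse-∷ʳ⁺ (leg-edge A p q e)
    ... | inj₂ (inj₁ p) | inj₂ (inj₁ q) = 1F , consec-via⁺ a Xa b (reverse Lb) y (inj₂ (consec-reverse-∷ʳ⁺ (leg-edge B p q e)))
    ... | inj₂ (inj₂ p) | inj₂ (inj₂ q) = 2F , consec-via⁺ a (reverse Xc) c (reverse Lc) z (inj₂ (consec-reverse-∷ʳ⁺ (leg-edge C p q e)))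
    ... | inj₁ p | inj₂ (inj₁ q) with refl , refl ← proj₂ (lAB p q) e = 3F , here-fw
    ... | inj₂ (inj₁ p) | inj₁ q with refl , refl ← proj₂ (lAB q p) (E-sym e) = 3F , here-bw
    ... | inj₁ p | inj₂ (inj₂ q) with refl , refl ← proj₂ (lAC p q) e = 4F , here-fw
    ... | inj₂ (inj₂ p) | inj₁ q with refl , refl ← proj₂ (lAC q p) (E-sym e) = 4F , here-bw
    ... | inj₂ (inj₁ p) | inj₂ (inj₂ q) with refl , refl ← proj₂ (lBC p q) e = 5F , here-fw
    ... | inj₂ (inj₂ p) | inj₂ (inj₁ q) with refl , refl ← proj₂ (lBC q p) (E-sym e) = 5F , here-bw

    on-path⇒edge : ∀ e {u v} → Consec (paths e) u v → E G u v
    on-path⇒edge 0F d = consec⇒edge (leg-path A) (consec-reverse-∷ʳ⁻ x La a d)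
    on-path⇒edge 1F d with consec-via⁻ a Xa b (reverse Lb) y d
    ... | inj₁ f = consec⇒edge K-path (consec-via⁺ c Xc a Xa b (inj₂ f))
    ... | inj₂ f = consec⇒edge (leg-path B) (consec-reverse-∷ʳ⁻ y Lb b f)
    on-path⇒edge 2F d with consec-via⁻ a (reverse Xc) c (reverse Lc) z d
    ... | inj₁ f = consec⇒edge K-path (consec-via⁺ c Xc a Xa b (inj₁ (consec-reverse-∷ʳ⁻ c Xc a f)))
    ... | inj₂ f = consec⇒edge (leg-path C) (consec-reverse-∷ʳ⁻ z Lc c f)
    on-path⇒edge 3F d = consec⇒edge (path-edge exy) d
    on-path⇒edge 4F d = consec⇒edge (path-edge exz) d
    on-path⇒edge 5F d = consec⇒edge (path-edge eyz) d

  record ListAppendix (Z : List V) (a c : V) (P : List V) : Set where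
    field
      appendix-path   : InducedPath (a ∷ P ∷ʳ c)
      appendix-off    : ∀ {v} → v ∈ P → v ∉ Z
      appendix-attach : ∀ {v z} → v ∈ P → z ∈ Z → E G v z → z ≡ a ⊎ z ≡ c
  open ListAppendix public

  appendix-reverse : ∀ {Z a c P} → ListAppendix Z a c P → ListAppendix Z c a (reverse P)
  appendix-reverse {Z} {a} {c} {P} A = record
    { appendix-path   = path-reverse-∷ʳ (appendix-path A)
    ; appendix-off    = λ m → appendix-off A (reverse⁻ m)
    ; appendix-attach = λ m mz e → swap (appendix-attach A (reverse⁻ m) mz e) }

  appendix-resp-⊆ : ∀ {Z Z′ a c P} → (∀ {v} → v ∈ Z′ → v ∈ Z) → ListAppendix Z a c P → ListAppendix Z′ a c P
  appendix-resp-⊆ Z′⊆Z A = record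
    { appendix-path   = appendix-path A
    ; appendix-off    = λ m mz → appendix-off A m (Z′⊆Z mz)
    ; appendix-attach = λ m mz e → appendix-attach A m (Z′⊆Z mz) e }

  appendix-split-path : ∀ {Z a c} K s K′ → ListAppendix Z a c (K ++ s ∷ K′) → InducedPath ((a ∷ K) ++ s ∷ (K′ ∷ʳ c))
  appendix-split-path {a = a} {c} K s K′ A = subst InducedPath (cong (a ∷_) (++-assoc K (s ∷ K′) [ c ])) (appendix-path A)

  -- The vertex s separates the part of an appendix before it from the last attachment,
  -- and the part after it from the first one.
  before-attach : ∀ {Z a c} K s K′ → ListAppendix Z a c (K ++ s ∷ K′) → ∀ {v z} → v ∈ K → z ∈ Z → E G v z → z ≡ a
  before-attach K s K′ A m mz e with appendix-attach A (∈-++⁺ˡ m) mz e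
  ... | inj₁ p    = p
  ... | inj₂ refl = ⊥-elim (proj₂ (path-separated (_ ∷ K) s (K′ ∷ʳ _) (appendix-split-path K s K′ A)
                                                   (there m) (∈-++⁺ʳ K′ (here refl))) e)

  after-attach : ∀ {Z a c} K s K′ → ListAppendix Z a c (K ++ s ∷ K′) → ∀ {v z} → v ∈ K′ → z ∈ Z → E G v z → z ≡ c
  after-attach K s K′ A m mz e with appendix-attach A (∈-++⁺ʳ K (there m)) mz e
  ... | inj₂ p    = p
  ... | inj₁ refl = ⊥-elim (proj₂ (path-separated (_ ∷ K) s (K′ ∷ʳ _) (appendix-split-path K s K′ A)
                                                   (here refl) (∈-++⁺ˡ m)) (E-sym e))

  appendix-prefix-leg : ∀ {Z a c} K s K′ → ListAppendix Z a c (K ++ s ∷ K′) → Leg Z s (reverse K) a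
  appendix-prefix-leg {a = a} {c} K s K′ A = record
    { leg-path   = path-reverse-∷ʳ (path-prefix (a ∷ K) s (K′ ∷ʳ c) (appendix-split-path K s K′ A))
    ; leg-off    = λ { (here refl) → appendix-off A (∈-++⁺ʳ K (here refl)) ; (there m) → appendix-off A (∈-++⁺ˡ (reverse⁻ {xs = K} m)) }
    ; leg-attach = λ m → before-attach K s K′ A (reverse⁻ {xs = K} m) }

  appendix-suffix-leg : ∀ {Z a c} K s K′ → ListAppendix Z a c (K ++ s ∷ K′) → Leg Z s K′ c
  appendix-suffix-leg {a = a} {c} K s K′ A = record
    { leg-path   = path-suffix (a ∷ K) s (K′ ∷ʳ c) (appendix-split-path K s K′ A)
    ; leg-off    = λ m → appendix-off A (∈-++⁺ʳ K m)
    ; leg-attach = after-attach K s K′ A }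

  apart-crossing-appendices⇒ISK4 : ∀ {a} {X₁ : List V} {b X₂ c X₃ d X₄ P Q} →
    let Z = a ∷ X₁ ++ b ∷ X₂ ++ c ∷ X₃ ++ d ∷ X₄ in
    InducedCycle Z → ListAppendix Z a c P → ListAppendix Z b d Q → Apart P Q → HasISK4 G
  apart-crossing-appendices⇒ISK4 {a} {X₁} {b} {X₂} {c} {X₃} {d} {X₄} {P} {Q} H AP AQ sPQ =
    InducedK4Subdivision⇒HasISK4 (record
      { branch          = br
      ; internal        = int
      ; vertices        = (P ++ Q) ++ Z
      ; vertices-↭      = ↭-trans (k4-vertices-↭ br int-unreversed unreverse)
          (solve 10 (λ a b c d x₁ p x₄ x₂ q x₃ →
                       (a ⊕ (b ⊕ (c ⊕ (d ⊕ id)))) ⊕ (x₁ ⊕ (p ⊕ (x₄ ⊕ (x₂ ⊕ (q ⊕ (x₃ ⊕ id)))))) ⊜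
                       (p ⊕ q) ⊕ (a ⊕ (x₁ ⊕ (b ⊕ (x₂ ⊕ (c ⊕ (x₃ ⊕ (d ⊕ x₄))))))))
                 ↭-refl [ a ] [ b ] [ c ] [ d ] X₁ P X₄ X₂ Q X₃)
      ; vertices-unique = ++⁺ (++⁺ (interior-unique AP) (interior-unique AQ) (λ (p , q) → proj₁ (sPQ p q) refl))
                              (cycle-unique H) (λ (m₁ , m₂) → [ appendix-off AP , appendix-off AQ ]′ (∈-++⁻ P m₁) m₂)
      ; edge⇒on-path    = edges-on-paths-++ (P ++ Q) Z appendix-edge appendix-to-cycle cycle-edge
      ; on-path⇒edge    = on-path⇒edge })
    where
    Z : List V
    Z = a ∷ X₁ ++ b ∷ X₂ ++ c ∷ X₃ ++ d ∷ X₄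
    open FourArcs a X₁ b X₂ c X₃ d X₄
    br : Fin 4 → V
    br = λ { 0F → a ; 1F → b ; 2F → c ; 3F → d }
    int : Fin 6 → List V
    int = λ { 0F → X₁ ; 1F → P ; 2F → reverse X₄ ; 3F → X₂ ; 4F → Q ; 5F → X₃ }
    int-unreversed : Fin 6 → List V
    int-unreversed = λ { 2F → X₄ ; e → int e }
    unreverse : ∀ e → int e ↭ int-unreversed e
    unreverse = λ { 0F → ↭-refl ; 1F → ↭-refl ; 2F → ↭-reverse X₄ ; 3F → ↭-refl ; 4F → ↭-refl ; 5F → ↭-refl }

    interior-unique : ∀ {s t R} → ListAppendix Z s t R → Unique R
    interior-unique {s} {R = R} A = Unique-tail (Unique-++⁻ˡ (s ∷ R) (unique (appendix-path A)))

    paths : Fin 6 → List V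
    paths = k4-path br int

    end-edge : ∀ {s t R u v} → ListAppendix Z s t R → u ∈ R → v ∈ Z → E G u v → Consec (s ∷ R ∷ʳ t) u v
    end-edge {s} {t} {R} A mu mv e with appendix-attach A mu mv e
    ... | inj₁ refl = edge⇒consec (appendix-path A) (there (∈-++⁺ˡ mu)) (here refl) e
    ... | inj₂ refl = edge⇒consec (appendix-path A) (there (∈-++⁺ˡ mu)) (∈-++⁺ʳ (s ∷ R) (here refl)) e

    appendix-edge : ∀ {u v} → u ∈ P ++ Q → v ∈ P ++ Q → E G u v → OnSomePath paths u v
    appendix-edge mu mv e with ∈-++⁻ P mu | ∈-++⁻ P mv
    ... | inj₁ p | inj₁ q = 1F , edge⇒consec (appendix-path AP) (there (∈-++⁺ˡ p)) (there (∈-++⁺ˡ q)) e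
    ... | inj₂ p | inj₂ q = 4F , edge⇒consec (appendix-path AQ) (there (∈-++⁺ˡ p)) (there (∈-++⁺ˡ q)) e
    ... | inj₁ p | inj₂ q = ⊥-elim (proj₂ (sPQ p q) e)
    ... | inj₂ p | inj₁ q = ⊥-elim (proj₂ (sPQ q p) (E-sym e))

    appendix-to-cycle : ∀ {u v} → u ∈ P ++ Q → v ∈ Z → E G u v → OnSomePath paths u v
    appendix-to-cycle mu mv e with ∈-++⁻ P mu
    ... | inj₁ p = 1F , end-edge AP p mv e
    ... | inj₂ q = 4F , end-edge AQ q mv e

    cycle-edge : ∀ {u v} → u ∈ Z → v ∈ Z → E G u v → OnSomePath paths u v
    cycle-edge mu mv e with arc-split (edge⇒cyc-consec H mu mv e)
    ... | inj₁ f = 0F , f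
    ... | inj₂ (inj₁ f) = 3F , f
    ... | inj₂ (inj₂ (inj₁ f)) = 5F , f
    ... | inj₂ (inj₂ (inj₂ f)) = 2F , consec-reverse-∷ʳ⁺ f

    on-path⇒edge : ∀ e {u v} → Consec (paths e) u v → E G u v
    on-path⇒edge 0F f = cyc-consec⇒edge H (arc₁ f)
    on-path⇒edge 1F f = consec⇒edge (appendix-path AP) f
    on-path⇒edge 2F f = cyc-consec⇒edge H (arc₄ (consec-reverse-∷ʳ⁻ d X₄ a f))
    on-path⇒edge 3F f = cyc-consec⇒edge H (arc₂ f)
    on-path⇒edge 4F f = consec⇒edge (appendix-path AQ) f
    on-path⇒edge 5F f = cyc-consec⇒edge H (arc₃ f)

  private
    appendix-edge₁ : ∀ {Z a c x} → ListAppendix Z a c [ x ] → E G x a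
    appendix-edge₁ A = consec⇒edge (appendix-path A) here-bw

    appendix-edge₂ : ∀ {Z a c x} → ListAppendix Z a c [ x ] → E G x c
    appendix-edge₂ A = consec⇒edge (appendix-path A) (there here-fw)


  record AdjacentCrossingVertices (a : V) (X₁ : List V) (b : V) (X₂ : List V) (c : V) (X₃ : List V)
                                  (d : V) (X₄ : List V) (x y : V) : Set where
    field
      hole       : InducedCycle (a ∷ X₁ ++ b ∷ X₂ ++ c ∷ X₃ ++ d ∷ X₄)
      x-appendix : ListAppendix (a ∷ X₁ ++ b ∷ X₂ ++ c ∷ X₃ ++ d ∷ X₄) a c [ x ]
      y-appendix : ListAppendix (a ∷ X₁ ++ b ∷ X₂ ++ c ∷ X₃ ++ d ∷ X₄) b d [ y ]
      x~y        : E G x y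

  rotate : ∀ {a X₁ b X₂ c X₃ d X₄ x y} →
           AdjacentCrossingVertices a X₁ b X₂ c X₃ d X₄ x y → AdjacentCrossingVertices b X₂ c X₃ d X₄ a X₁ y x
  rotate {a} {X₁} {b} {X₂} {c} {X₃} {d} {X₄} C = record
    { hole       = cycle-rotate₄ hole
    ; x-appendix = appendix-resp-⊆ (∈-rotate₄ {a} {X₁} {b} {X₂} {c} {X₃} {d} {X₄}) y-appendix
    ; y-appendix = appendix-resp-⊆ (∈-rotate₄ {a} {X₁} {b} {X₂} {c} {X₃} {d} {X₄}) (appendix-reverse x-appendix)
    ; x~y        = E-sym x~y }
    where open AdjacentCrossingVertices C

  adjacent-crossing-vertices⇒ISK4 : ∀ {a w X₁ b X₂ c X₃ d X₄ x y} →
    AdjacentCrossingVertices a (w ∷ X₁) b X₂ c X₃ d X₄ x y → HasISK4 G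
  adjacent-crossing-vertices⇒ISK4 {a} {w} {X₁} {b} {X₂} {c} {X₃} {d} {X₄} {x} {y} C =
    InducedK4Subdivision⇒HasISK4 (record
      { branch          = br
      ; internal        = int
      ; vertices        = (x ∷ y ∷ []) ++ K
      ; vertices-↭      = ↭-trans (k4-vertices-↭ br int-unreversed unreverse)
          (solve 9 (λ x y c d a b x₄ x₂ x₃ →
                       (x ⊕ (y ⊕ (c ⊕ (d ⊕ id)))) ⊕ (id ⊕ (id ⊕ ((a ⊕ x₄) ⊕ ((b ⊕ x₂) ⊕ (id ⊕ (x₃ ⊕ id)))))) ⊜
                       x ⊕ (y ⊕ (b ⊕ ((x₂ ⊕ (c ⊕ (x₃ ⊕ (d ⊕ x₄)))) ⊕ a))))
                 ↭-refl [ x ] [ y ] [ c ] [ d ] [ a ] [ b ] X₄ X₂ X₃)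
      ; vertices-unique = Unique-∷ x∉ (Unique-∷ (λ m → appendix-off AQ (here refl) (∈-complement m)) (unique K-path))
      ; edge⇒on-path    = edges-on-paths-++ (x ∷ y ∷ []) K xy-edge to-cycle cycle-edge
      ; on-path⇒edge    = on-path⇒edge })
    where
    open AdjacentCrossingVertices C renaming (hole to H; x-appendix to AP; y-appendix to AQ; x~y to exy)
    K : List V
    K = b ∷ (X₂ ++ c ∷ X₃ ++ d ∷ X₄) ∷ʳ a
    br : Fin 4 → V
    br = λ { 0F → x ; 1F → y ; 2F → c ; 3F → d }
    int : Fin 6 → List V
    int = λ { 2F → a ∷ reverse X₄ ; 3F → b ∷ X₂ ; 5F → X₃ ; _ → [] }
    int-unreversed : Fin 6 → List V
    int-unreversed = λ { 2F → a ∷ X₄ ; e → int e }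
    unreverse : ∀ e → int e ↭ int-unreversed e
    unreverse = λ { 0F → ↭-refl ; 1F → ↭-refl ; 2F → prep a (↭-reverse X₄) ; 3F → ↭-refl ; 4F → ↭-refl ; 5F → ↭-refl }

    K-path : InducedPath K
    K-path = cycle-complement a w X₁ b (X₂ ++ c ∷ X₃ ++ d ∷ X₄) H
    x∉ : x ∉ y ∷ K
    x∉ (here p)  = E⇒≢ exy p
    x∉ (there m) = appendix-off AP (here refl) (∈-complement m)

    along-K : ∀ {u v} → Consec (b ∷ X₂ ∷ʳ c) u v ⊎ Consec (c ∷ X₃ ∷ʳ d) u v ⊎ Consec (d ∷ X₄ ∷ʳ a) u v → Consec K u v
    along-K (inj₁ f)        = consec-via⁺ b X₂ c (X₃ ++ d ∷ X₄) a (inj₁ f)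
    along-K (inj₂ (inj₁ f)) = consec-via⁺ b X₂ c (X₃ ++ d ∷ X₄) a (inj₂ (consec-via⁺ c X₃ d X₄ a (inj₁ f)))
    along-K (inj₂ (inj₂ f)) = consec-via⁺ b X₂ c (X₃ ++ d ∷ X₄) a (inj₂ (consec-via⁺ c X₃ d X₄ a (inj₂ f)))

    paths : Fin 6 → List V
    paths = k4-path br int

    cycle-edge : ∀ {u v} → u ∈ K → v ∈ K → E G u v → OnSomePath paths u v
    cycle-edge mu mv e with consec-via⁻ b X₂ c (X₃ ++ d ∷ X₄) a (edge⇒consec K-path mu mv e)
    ... | inj₁ f = 3F , there f
    ... | inj₂ g with consec-via⁻ c X₃ d X₄ a g
    ...   | inj₁ f = 5F , f
    ...   | inj₂ f = 2F , there (consec-reverse-∷ʳ⁺ f)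

    xy-edge : ∀ {u v} → u ∈ x ∷ y ∷ [] → v ∈ x ∷ y ∷ [] → E G u v → OnSomePath paths u v
    xy-edge (here refl)         (here refl)         e = ⊥-elim (E-irrefl e)
    xy-edge (here refl)         (there (here refl)) e = 0F , here-fw
    xy-edge (there (here refl)) (here refl)         e = 0F , here-bw
    xy-edge (there (here refl)) (there (here refl)) e = ⊥-elim (E-irrefl e)

    to-cycle : ∀ {u v} → u ∈ x ∷ y ∷ [] → v ∈ K → E G u v → OnSomePath paths u v
    to-cycle (here refl) m e with appendix-attach AP (here refl) (∈-complement m) e
    ... | inj₁ refl = 2F , here-fw
    ... | inj₂ refl = 1F , here-fw
    to-cycle (there (here refl)) m e with appendix-attach AQ (here refl) (∈-complement m) e
    ... | inj₁ refl = 3F , here-fw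
    ... | inj₂ refl = 4F , here-fw

    on-path⇒edge : ∀ e {u v} → Consec (paths e) u v → E G u v
    on-path⇒edge 0F f         = consec⇒edge (path-edge exy) f
    on-path⇒edge 1F f         = consec⇒edge (path-edge (appendix-edge₂ AP)) f
    on-path⇒edge 2F here-fw   = appendix-edge₁ AP
    on-path⇒edge 2F here-bw   = E-sym (appendix-edge₁ AP)
    on-path⇒edge 2F (there f) = consec⇒edge K-path (along-K (inj₂ (inj₂ (consec-reverse-∷ʳ⁻ d X₄ a f))))
    on-path⇒edge 3F here-fw   = appendix-edge₁ AQ
    on-path⇒edge 3F here-bw   = E-sym (appendix-edge₁ AQ)
    on-path⇒edge 3F (there f) = consec⇒edge K-path (along-K (inj₁ f))
    on-path⇒edge 4F f         = consec⇒edge (path-edge (appendix-edge₂ AQ)) f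
    on-path⇒edge 5F f         = consec⇒edge K-path (along-K (inj₂ (inj₁ f)))

  -- The sides of the K3,3 are {x, b, d} and {y, a, c}.
  adjacent-crossing-vertices⇒K33 : ∀ {a b c d x y} → AdjacentCrossingVertices a [] b [] c [] d [] x y → Contains G K33
  adjacent-crossing-vertices⇒K33 {a} {b} {c} {d} {x} {y} C =
    K33-intro exy (appendix-edge₁ AP) (appendix-edge₂ AP)
              (E-sym (appendix-edge₁ AQ)) (E-sym eab) ebc (E-sym (appendix-edge₂ AQ)) eda (E-sym ecd)
              x≁b x≁d (cycle-opposite-nonadjacent [] [] [] [] (cycle-rotate₄ {a} {[]} {b} {[]} {c} {[]} {d} {[]} H))
              y≁a y≁c (cycle-opposite-nonadjacent [] [] [] [] H)
              (x≢ (there (here refl))) (x≢ (there (there (there (here refl))))) b≢d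
              (y≢ (here refl)) (y≢ (there (there (here refl)))) a≢c
    where
    open AdjacentCrossingVertices C renaming (hole to H; x-appendix to AP; y-appendix to AQ; x~y to exy)
    U : Unique (a ∷ b ∷ c ∷ d ∷ [])
    U = cycle-unique H
    distinct : ∀ i j → i ≢ j → lookup (a ∷ b ∷ c ∷ d ∷ []) i ≢ lookup (a ∷ b ∷ c ∷ d ∷ []) j
    distinct i j i≢j p = i≢j (lookup-injective U p)
    a≢c : a ≢ c
    a≢c = distinct 0F 2F (λ ())
    b≢d : b ≢ d
    b≢d = distinct 1F 3F (λ ())
    x≢ : ∀ {v} → v ∈ a ∷ b ∷ c ∷ d ∷ [] → x ≢ v
    x≢ m refl = appendix-off AP (here refl) m
    y≢ : ∀ {v} → v ∈ a ∷ b ∷ c ∷ d ∷ [] → y ≢ v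
    y≢ m refl = appendix-off AQ (here refl) m
    x≁b : ¬ E G x b
    x≁b e = [ distinct 1F 0F (λ ()) , distinct 1F 2F (λ ()) ]′ (appendix-attach AP (here refl) (there (here refl)) e)
    x≁d : ¬ E G x d
    x≁d e = [ distinct 3F 0F (λ ()) , distinct 3F 2F (λ ()) ]′ (appendix-attach AP (here refl) (there (there (there (here refl)))) e)
    y≁a : ¬ E G y a
    y≁a e = [ distinct 0F 1F (λ ()) , distinct 0F 3F (λ ()) ]′ (appendix-attach AQ (here refl) (here refl) e)
    y≁c : ¬ E G y c
    y≁c e = [ distinct 2F 1F (λ ()) , distinct 2F 3F (λ ()) ]′ (appendix-attach AQ (here refl) (there (there (here refl))) e)
    eab : E G a b
    eab = cyc-consec⇒edge H here-fw
    ebc : E G b c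
    ebc = cyc-consec⇒edge H (there here-fw)
    ecd : E G c d
    ecd = cyc-consec⇒edge H (there (there here-fw))
    eda : E G d a
    eda = cyc-consec⇒edge H (there (there (there here-fw)))

  adjacent-crossing-vertices⇒ISK4⊎K33 : ∀ {a X₁ b X₂ c X₃ d X₄ x y} →
    AdjacentCrossingVertices a X₁ b X₂ c X₃ d X₄ x y → HasISK4 G ⊎ Contains G K33
  adjacent-crossing-vertices⇒ISK4⊎K33 {X₁ = _ ∷ _} C =
    inj₁ (adjacent-crossing-vertices⇒ISK4 C)
  adjacent-crossing-vertices⇒ISK4⊎K33 {X₁ = []} {X₂ = _ ∷ _} C =
    inj₁ (adjacent-crossing-vertices⇒ISK4 (rotate C))
  adjacent-crossing-vertices⇒ISK4⊎K33 {X₁ = []} {X₂ = []} {X₃ = _ ∷ _} C =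
    inj₁ (adjacent-crossing-vertices⇒ISK4 (rotate (rotate C)))
  adjacent-crossing-vertices⇒ISK4⊎K33 {X₁ = []} {X₂ = []} {X₃ = []} {X₄ = _ ∷ _} C =
    inj₁ (adjacent-crossing-vertices⇒ISK4 (rotate (rotate (rotate C))))
  adjacent-crossing-vertices⇒ISK4⊎K33 {X₁ = []} {X₂ = []} {X₃ = []} {X₄ = []} C =
    inj₂ (adjacent-crossing-vertices⇒K33 C)

module CrossingAppendices {n : ℕ} (G : Graph n) where
  open InducedPaths G
  open InducedCycles G
  open Configurations G

  Touches : V → List V → Set
  Touches v Q = Any (λ q → v ≡ q ⊎ E G v q) Q

  Touches? : ∀ Q → Decidable (λ v → Touches v Q)
  Touches? Q v = any? (λ q → (v ≟ q) ⊎-dec (E? v q)) Q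

  untouched⇒apart : ∀ {A Q} → All (λ v → ¬ Touches v Q) A → Apart A Q
  untouched⇒apart none mv mw = (λ p → ¬t (lose mw (inj₁ p))) , (λ e → ¬t (lose mw (inj₂ e)))
    where ¬t = All.lookup none mv

  -- x is the first vertex of the appendix A ++ x ∷ b ∷ B that touches the other appendix.
  module FirstContact {u₁ : V} {X₁ : List V} {v₁ w : V} {W : List V} {v₂ : V} {X₄ : List V} {u₂ : V}
                      (H : InducedCycle (u₁ ∷ X₁ ++ v₁ ∷ (w ∷ W) ++ v₂ ∷ X₄))
                      {A : List V} {x b : V} {B : List V}
                      (AP : ListAppendix (u₁ ∷ X₁ ++ v₁ ∷ (w ∷ W) ++ v₂ ∷ X₄) u₁ u₂ (A ++ x ∷ b ∷ B)) where

    Z : List V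
    Z = u₁ ∷ X₁ ++ v₁ ∷ (w ∷ W) ++ v₂ ∷ X₄

    v₁∈Z : v₁ ∈ Z
    v₁∈Z = there (∈-++⁺ʳ X₁ (here refl))

    v₂∈Z : v₂ ∈ Z
    v₂∈Z = there (∈-++⁺ʳ X₁ (there (∈-++⁺ʳ (w ∷ W) (here refl))))

    u₁≢v₁ : u₁ ≢ v₁
    u₁≢v₁ p = Unique[x∷xs]⇒x∉xs (cycle-unique H) (subst (_∈ _) (sym p) (∈-++⁺ʳ X₁ (here refl)))

    u₁≢v₂ : u₁ ≢ v₂
    u₁≢v₂ p = Unique[x∷xs]⇒x∉xs (cycle-unique H) (subst (_∈ _) (sym p) (∈-++⁺ʳ X₁ (there (∈-++⁺ʳ (w ∷ W) (here refl)))))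

    x-leg : Leg Z x (reverse A) u₁
    x-leg = appendix-prefix-leg A x (b ∷ B) AP

    x∉Z : x ∉ Z
    x∉Z = leg-off x-leg (here refl)

    x-attach : ∀ {z} → z ∈ Z → E G x z → z ≡ u₁
    x-attach = before-attach (A ∷ʳ x) b B (subst (ListAppendix Z u₁ u₂) (sym (∷ʳ-++ A x (b ∷ B))) AP) (∈-++⁺ʳ A (here refl))

    x≁v₁ : ¬ E G x v₁
    x≁v₁ e = u₁≢v₁ (sym (x-attach v₁∈Z e))

    x≁v₂ : ¬ E G x v₂
    x≁v₂ e = u₁≢v₂ (sym (x-attach v₂∈Z e))

    Q-misses-u₁ : ∀ {Q q} → ListAppendix Z v₁ v₂ Q → q ∈ Q → ¬ E G q u₁
    Q-misses-u₁ AQ m e = [ u₁≢v₁ , u₁≢v₂ ]′ (appendix-attach AQ m (here refl) e)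

    -- The predecessor of x on the appendix (u₁ or a vertex of A) would touch Q.
    x∉Q : ∀ {Q} → ListAppendix Z v₁ v₂ Q → Apart A Q → x ∉ Q
    x∉Q AQ sA m with consec-predecessor u₁ A {x} {(b ∷ B) ∷ʳ u₂}
    ... | p , inj₁ refl , c = Q-misses-u₁ AQ m (E-sym (consec⇒edge (appendix-split-path A x (b ∷ B) AP) c))
    ... | p , inj₂ p∈A  , c = proj₂ (sA p∈A m) (consec⇒edge (appendix-split-path A x (b ∷ B) AP) c)

    x-apart : ∀ {Q M} → ListAppendix Z v₁ v₂ Q → Apart A Q → (∀ {v} → v ∈ M → v ∈ Q) →
              (∀ {v} → v ∈ M → ¬ E G x v) → Apart [ x ] M
    x-apart AQ sA M⊆Q x≁M (here refl) m = (λ p → x∉Q AQ sA (subst (_∈ _) (sym p) (M⊆Q m))) , x≁M m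

    tripod-at-y : ∀ {M₁ y M₂} → ListAppendix Z v₁ v₂ (M₁ ++ y ∷ M₂) → Apart A (M₁ ++ y ∷ M₂) →
                  E G x y → All (λ v → ¬ E G x v) M₁ → All (λ v → ¬ E G x v) M₂ → HasISK4 G
    tripod-at-y {M₁} {y} {M₂} AQ sA exy x≁M₁ x≁M₂ =
      tripod⇒ISK4 {u₁} {X₁} {v₁} {w ∷ W} {v₂} {X₄} H A-leg (appendix-prefix-leg M₁ y M₂ AQ) (appendix-suffix-leg M₁ y M₂ AQ)
        (apart-∷ (x-apart AQ sA M₁⊆Q (λ m → All.lookup x≁M₁ (reverse⁻ {xs = M₁} m))) (apart-mono (reverse⁻ {xs = A}) M₁⊆Q sA))
        (apart-∷ (x-apart AQ sA M₂⊆Q (All.lookup x≁M₂)) (apart-mono (reverse⁻ {xs = A}) M₂⊆Q sA))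
        (apart-mono (λ m → there (reverse⁻ {xs = M₁} m)) ∈-++⁺ˡ
                    (path-separated (v₁ ∷ M₁) y (M₂ ∷ʳ v₂) (appendix-split-path M₁ y M₂ AQ)))
        (λ mz e → [ (λ p → inj₂ (inj₁ p)) , (λ p → inj₂ (inj₂ p)) ]′ (appendix-attach AQ y∈Q mz e))
      where
      y∈Q : y ∈ M₁ ++ y ∷ M₂
      y∈Q = ∈-++⁺ʳ M₁ (here refl)
      M₁⊆Q : ∀ {v} → v ∈ reverse M₁ → v ∈ M₁ ++ y ∷ M₂
      M₁⊆Q m = ∈-++⁺ˡ (reverse⁻ {xs = M₁} m)
      M₂⊆Q : ∀ {v} → v ∈ M₂ → v ∈ M₁ ++ y ∷ M₂
      M₂⊆Q m = ∈-++⁺ʳ M₁ (there m)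
      A-leg : Leg Z y (x ∷ reverse A) u₁
      A-leg = leg-cons x-leg (E-sym exy) (appendix-off AQ y∈Q) (here refl) (Q-misses-u₁ AQ y∈Q)
                (apart-mono (λ { (here refl) → y∈Q }) (reverse⁻ {xs = A}) (apart-sym sA)) x-attach

    tripod-at-x : ∀ {M₁ y n N y′ N₂} → ListAppendix Z v₁ v₂ (M₁ ++ y ∷ (n ∷ N) ++ y′ ∷ N₂) →
                  Apart A (M₁ ++ y ∷ (n ∷ N) ++ y′ ∷ N₂) →
                  E G x y → All (λ v → ¬ E G x v) M₁ → E G x y′ → All (λ v → ¬ E G x v) N₂ → HasISK4 G
    tripod-at-x {M₁} {y} {n} {N} {y′} {N₂} AQ sA exy x≁M₁ exy′ x≁N₂ =
      tripod⇒ISK4 {u₁} {X₁} {v₁} {w ∷ W} {v₂} {X₄} H x-leg B-leg C-leg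
        (apart-mono (reverse⁻ {xs = A}) B⊆Q sA) (apart-mono (reverse⁻ {xs = A}) C⊆Q sA)
        (apart-mono (λ { (here refl) → there (∈-++⁺ʳ M₁ (here refl)) ; (there m) → there (∈-++⁺ˡ (reverse⁻ {xs = M₁} m)) })
                    (λ m → ∈-++⁺ˡ (∈-++⁺ʳ N m))
                    (path-separated (v₁ ∷ M₁ ∷ʳ y) n ((N ++ y′ ∷ N₂) ∷ʳ v₂) (appendix-split-path (M₁ ∷ʳ y) n _ AQ-at-n)))
        (λ mz e → inj₁ (x-attach mz e))
      where
      Q : List V
      Q = M₁ ++ y ∷ (n ∷ N) ++ y′ ∷ N₂
      AQ-at-n : ListAppendix Z v₁ v₂ ((M₁ ∷ʳ y) ++ n ∷ (N ++ y′ ∷ N₂))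
      AQ-at-n = subst (ListAppendix Z v₁ v₂) (sym (∷ʳ-++ M₁ y _)) AQ
      AQ-at-y′ : ListAppendix Z v₁ v₂ ((M₁ ++ y ∷ n ∷ N) ++ y′ ∷ N₂)
      AQ-at-y′ = subst (ListAppendix Z v₁ v₂) (sym (++-assoc M₁ (y ∷ n ∷ N) (y′ ∷ N₂))) AQ
      B⊆Q : ∀ {v} → v ∈ y ∷ reverse M₁ → v ∈ Q
      B⊆Q (here refl) = ∈-++⁺ʳ M₁ (here refl)
      B⊆Q (there m)   = ∈-++⁺ˡ (reverse⁻ {xs = M₁} m)
      C⊆Q : ∀ {v} → v ∈ y′ ∷ N₂ → v ∈ Q
      C⊆Q m = ∈-++⁺ʳ M₁ (there (∈-++⁺ʳ (n ∷ N) m))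
      B-leg : Leg Z x (y ∷ reverse M₁) v₁
      B-leg = leg-cons (appendix-prefix-leg M₁ y _ AQ) exy x∉Z v₁∈Z x≁v₁
                (x-apart AQ sA (λ m → B⊆Q (there m)) (λ m → All.lookup x≁M₁ (reverse⁻ {xs = M₁} m)))
                (before-attach (M₁ ∷ʳ y) n _ AQ-at-n (∈-++⁺ʳ M₁ (here refl)))
      C-leg : Leg Z x (y′ ∷ N₂) v₂
      C-leg = leg-cons (appendix-suffix-leg (M₁ ++ y ∷ n ∷ N) y′ N₂ AQ-at-y′) exy′ x∉Z v₂∈Z x≁v₂
                (x-apart AQ sA (λ m → C⊆Q (there m)) (All.lookup x≁N₂))
                (after-attach M₁ y _ AQ (∈-++⁺ʳ (n ∷ N) (here refl)))

    prism-at-x : ∀ {M₁ y y′ M₃} → ListAppendix Z v₁ v₂ (M₁ ++ y ∷ y′ ∷ M₃) → Apart A (M₁ ++ y ∷ y′ ∷ M₃) →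
                 E G x y → All (λ v → ¬ E G x v) M₁ → E G x y′ → All (λ v → ¬ E G x v) M₃ → HasISK4 G
    prism-at-x {M₁} {y} {y′} {M₃} AQ sA exy x≁M₁ exy′ x≁M₃ =
      prism⇒ISK4 {u₁} {X₁} {v₁} {w} {W} {v₂} {X₄} H x-leg
        (appendix-prefix-leg M₁ y (y′ ∷ M₃) AQ) (appendix-suffix-leg (M₁ ∷ʳ y) y′ M₃ AQ-at-y′)
        exy exy′ (consec⇒edge Q-path (consec-middle (v₁ ∷ M₁)))
        (linked-if-apart (λ p → x∉Q AQ sA (subst (_∈ _) (sym p) y∈Q))
           (x-apart AQ sA (λ m → ∈-++⁺ˡ (reverse⁻ {xs = M₁} m)) (λ m → All.lookup x≁M₁ (reverse⁻ {xs = M₁} m)))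
           (apart-mono (reverse⁻ {xs = A}) (λ { (here refl) → y∈Q ; (there m) → ∈-++⁺ˡ (reverse⁻ {xs = M₁} m) }) sA))
        (linked-if-apart (λ p → x∉Q AQ sA (subst (_∈ _) (sym p) y′∈Q))
           (x-apart AQ sA M₃⊆Q (All.lookup x≁M₃))
           (apart-mono (reverse⁻ {xs = A}) (λ { (here refl) → y′∈Q ; (there m) → M₃⊆Q m }) sA))
        (path-linked (v₁ ∷ M₁) y y′ (M₃ ∷ʳ v₂) Q-path (λ m → there (reverse⁻ {xs = M₁} m)) ∈-++⁺ˡ)
        x-attach
        (before-attach (M₁ ∷ʳ y) y′ M₃ AQ-at-y′ (∈-++⁺ʳ M₁ (here refl)))
        (after-attach M₁ y (y′ ∷ M₃) AQ (here refl))
      where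
      AQ-at-y′ : ListAppendix Z v₁ v₂ ((M₁ ∷ʳ y) ++ y′ ∷ M₃)
      AQ-at-y′ = subst (ListAppendix Z v₁ v₂) (sym (∷ʳ-++ M₁ y (y′ ∷ M₃))) AQ
      Q-path : InducedPath ((v₁ ∷ M₁) ++ y ∷ y′ ∷ M₃ ∷ʳ v₂)
      Q-path = appendix-split-path M₁ y (y′ ∷ M₃) AQ
      y∈Q : y ∈ M₁ ++ y ∷ y′ ∷ M₃
      y∈Q = ∈-++⁺ʳ M₁ (here refl)
      y′∈Q : y′ ∈ M₁ ++ y ∷ y′ ∷ M₃
      y′∈Q = ∈-++⁺ʳ M₁ (there (here refl))
      M₃⊆Q : ∀ {v} → v ∈ M₃ → v ∈ M₁ ++ y ∷ y′ ∷ M₃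
      M₃⊆Q m = ∈-++⁺ʳ M₁ (there (there m))

    -- Split Q at the first neighbour y and the last neighbour y′ of x: if y = y′ the hole with
    -- legs from y is a tripod, if y y′ is an edge of Q the triangle x y y′ gives a prism, and
    -- otherwise the hole with legs from x is a tripod.
    first-contact⇒ISK4 : ∀ {Q} → ListAppendix Z v₁ v₂ Q → Apart A Q → Touches x Q → HasISK4 G
    first-contact⇒ISK4 {Q} AQ sA tx with first-satisfying (E? x) Q
    ... | inj₁ x≁Q with find tx
    ...   | q , q∈Q , inj₁ refl = ⊥-elim (x∉Q AQ sA q∈Q)
    ...   | q , q∈Q , inj₂ e    = ⊥-elim (All.lookup x≁Q q∈Q e)
    first-contact⇒ISK4 AQ sA tx | inj₂ (first-view x≁M₁ exy M₂) with last-satisfying (E? x) M₂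
    ... | inj₁ x≁M₂                           = tripod-at-y AQ sA exy x≁M₁ x≁M₂
    ... | inj₂ (last-view []      exy′ x≁M₃) = prism-at-x AQ sA exy x≁M₁ exy′ x≁M₃
    ... | inj₂ (last-view (_ ∷ _) exy′ x≁N₂) = tripod-at-x AQ sA exy x≁M₁ exy′ x≁N₂

  contact⇒ISK4 : ∀ {u₁ X₁ v₁ X₂ u₂ X₃ v₂ X₄ A x b B Q} →
    let Z = u₁ ∷ X₁ ++ v₁ ∷ X₂ ++ u₂ ∷ X₃ ++ v₂ ∷ X₄ in
    InducedCycle Z → ListAppendix Z u₁ u₂ (A ++ x ∷ b ∷ B) → ListAppendix Z v₁ v₂ Q → Apart A Q → Touches x Q → HasISK4 G
  contact⇒ISK4 {u₁} {X₁} {v₁} {X₂} {u₂} {X₃} {v₂} {X₄} {A} {x} {b} {B} {Q} H AP AQ sA tx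
    with ++-∷-nonempty X₂ u₂ X₃
  ... | w , W , eq = FirstContact.first-contact⇒ISK4 (subst InducedCycle Z≡ H)
                       (subst (λ Z → ListAppendix Z u₁ u₂ (A ++ x ∷ b ∷ B)) Z≡ AP)
                       (subst (λ Z → ListAppendix Z v₁ v₂ Q) Z≡ AQ) sA tx
    where
    Z≡ : u₁ ∷ X₁ ++ v₁ ∷ X₂ ++ u₂ ∷ X₃ ++ v₂ ∷ X₄ ≡ u₁ ∷ X₁ ++ v₁ ∷ (w ∷ W) ++ v₂ ∷ X₄
    Z≡ = cong (λ l → u₁ ∷ X₁ ++ v₁ ∷ l) (trans (sym (++-assoc X₂ (u₂ ∷ X₃) (v₂ ∷ X₄))) (cong (_++ v₂ ∷ X₄) eq))

  module Rotations {u₁ : V} {X₁ : List V} {v₁ : V} {X₂ : List V} {u₂ : V} {X₃ : List V} {v₂ : V} {X₄ : List V}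
                   (H : InducedCycle (u₁ ∷ X₁ ++ v₁ ∷ X₂ ++ u₂ ∷ X₃ ++ v₂ ∷ X₄)) where
    H₁ : InducedCycle (v₁ ∷ X₂ ++ u₂ ∷ X₃ ++ v₂ ∷ X₄ ++ u₁ ∷ X₁)
    H₁ = cycle-rotate₄ H
    H₂ : InducedCycle (u₂ ∷ X₃ ++ v₂ ∷ X₄ ++ u₁ ∷ X₁ ++ v₁ ∷ X₂)
    H₂ = cycle-rotate₄ H₁
    H₃ : InducedCycle (v₂ ∷ X₄ ++ u₁ ∷ X₁ ++ v₁ ∷ X₂ ++ u₂ ∷ X₃)
    H₃ = cycle-rotate₄ H₂

    Z₁⊆Z : ∀ {v} → v ∈ v₁ ∷ X₂ ++ u₂ ∷ X₃ ++ v₂ ∷ X₄ ++ u₁ ∷ X₁ → v ∈ u₁ ∷ X₁ ++ v₁ ∷ X₂ ++ u₂ ∷ X₃ ++ v₂ ∷ X₄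
    Z₁⊆Z = ∈-rotate₄ {u₁} {X₁} {v₁} {X₂} {u₂} {X₃} {v₂} {X₄}

    Z₂⊆Z : ∀ {v} → v ∈ u₂ ∷ X₃ ++ v₂ ∷ X₄ ++ u₁ ∷ X₁ ++ v₁ ∷ X₂ → v ∈ u₁ ∷ X₁ ++ v₁ ∷ X₂ ++ u₂ ∷ X₃ ++ v₂ ∷ X₄
    Z₂⊆Z m = Z₁⊆Z (∈-rotate₄ {v₁} {X₂} {u₂} {X₃} {v₂} {X₄} {u₁} {X₁} m)

    Z₃⊆Z : ∀ {v} → v ∈ v₂ ∷ X₄ ++ u₁ ∷ X₁ ++ v₁ ∷ X₂ ++ u₂ ∷ X₃ → v ∈ u₁ ∷ X₁ ++ v₁ ∷ X₂ ++ u₂ ∷ X₃ ++ v₂ ∷ X₄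
    Z₃⊆Z m = Z₂⊆Z (∈-rotate₄ {u₂} {X₃} {v₂} {X₄} {u₁} {X₁} {v₁} {X₂} m)

  -- Let x be the first vertex of P touching Q. Up to reversing P, or exchanging P and Q,
  -- x has a successor on P, unless P and Q are single vertices.
  crossing-appendices⇒ISK4⊎K33 : ∀ {u₁ X₁ v₁ X₂ u₂ X₃ v₂ X₄ P Q} →
    let Z = u₁ ∷ X₁ ++ v₁ ∷ X₂ ++ u₂ ∷ X₃ ++ v₂ ∷ X₄ in
    InducedCycle Z → ListAppendix Z u₁ u₂ P → ListAppendix Z v₁ v₂ Q → HasISK4 G ⊎ Contains G K33
  crossing-appendices⇒ISK4⊎K33 {u₁} {X₁} {v₁} {X₂} {u₂} {X₃} {v₂} {X₄} {P} {Q} H AP AQ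
    with first-satisfying (Touches? Q) P
  ... | inj₁ P≁Q = inj₁ (apart-crossing-appendices⇒ISK4 H AP AQ (untouched⇒apart P≁Q))
  ... | inj₂ (first-view A≁Q tx (_ ∷ _)) = inj₁ (contact⇒ISK4 H AP AQ (untouched⇒apart A≁Q) tx)
  ... | inj₂ (first-view {xs = A} {y = x} _ tx []) with initLast A
  ...   | A′ ∷ʳ′ l = inj₁ (contact⇒ISK4 {A = []} H₂ AP₂ (appendix-resp-⊆ Z₂⊆Z (appendix-reverse AQ)) (λ ()) (reverse⁺ tx))
    where
    open Rotations H
    AP₂ : ListAppendix (u₂ ∷ X₃ ++ v₂ ∷ X₄ ++ u₁ ∷ X₁ ++ v₁ ∷ X₂) u₂ u₁ ([] ++ x ∷ l ∷ reverse A′)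
    AP₂ = subst (ListAppendix _ u₂ u₁) (reverse-∷ʳ-∷ʳ A′ l x) (appendix-resp-⊆ Z₂⊆Z (appendix-reverse AP))
  ...   | [] with first-satisfying (Touches? [ x ]) Q
  ...     | inj₁ Q≁x with find tx
  ...       | q , q∈Q , inj₁ refl = ⊥-elim (All.lookup Q≁x q∈Q (here (inj₁ refl)))
  ...       | q , q∈Q , inj₂ e    = ⊥-elim (All.lookup Q≁x q∈Q (here (inj₂ (E-sym e))))
  crossing-appendices⇒ISK4⊎K33 H AP AQ | inj₂ (first-view _ _ []) | [] | inj₂ (first-view C≁x tq (_ ∷ _)) =
    inj₁ (contact⇒ISK4 H₁ (appendix-resp-⊆ Z₁⊆Z AQ) (appendix-resp-⊆ Z₁⊆Z (appendix-reverse AP)) (untouched⇒apart C≁x) tq)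
    where open Rotations H
  crossing-appendices⇒ISK4⊎K33 {u₁} {X₁} {v₁} {X₂} {u₂} {X₃} {v₂} {X₄} H AP AQ
    | inj₂ (first-view {y = x} _ _ []) | [] | inj₂ (first-view {xs = C} {y = q} _ tq []) with initLast C
  ... | C′ ∷ʳ′ l = inj₁ (contact⇒ISK4 {A = []} H₃ AQ₃ (appendix-resp-⊆ Z₃⊆Z AP) (λ ()) tq)
    where
    open Rotations H
    AQ₃ : ListAppendix (v₂ ∷ X₄ ++ u₁ ∷ X₁ ++ v₁ ∷ X₂ ++ u₂ ∷ X₃) v₂ v₁ ([] ++ q ∷ l ∷ reverse C′)
    AQ₃ = subst (ListAppendix _ v₂ v₁) (reverse-∷ʳ-∷ʳ C′ l q) (appendix-resp-⊆ Z₃⊆Z (appendix-reverse AQ))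
  ... | [] = adjacent-crossing-vertices⇒ISK4⊎K33 (record { hole = H ; x-appendix = AP ; y-appendix = AQ ; x~y = x~q tq })
    where
    U : Unique (u₁ ∷ X₁ ++ v₁ ∷ X₂ ++ u₂ ∷ X₃ ++ v₂ ∷ X₄)
    U = cycle-unique H
    u₁≢v₁ : u₁ ≢ v₁
    u₁≢v₁ p = Unique[x∷xs]⇒x∉xs U (subst (_∈ _) (sym p) (∈-++⁺ʳ X₁ (here refl)))
    u₁≢v₂ : u₁ ≢ v₂
    u₁≢v₂ p = Unique[x∷xs]⇒x∉xs U (subst (_∈ _) (sym p) (∈-++⁺ʳ X₁ (there (∈-++⁺ʳ X₂ (there (∈-++⁺ʳ X₃ (here refl)))))))
    x~q : Touches q [ x ] → E G x q
    x~q (here (inj₂ e))    = E-sym e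
    x~q (here (inj₁ refl)) = ⊥-elim ([ u₁≢v₁ , u₁≢v₂ ]′
                               (appendix-attach AQ (here refl) (here refl) (E-sym (consec⇒edge (appendix-path AP) here-fw))))

module FromRecords {n : ℕ} (G : Graph n) where
  open InducedPaths G
  open InducedCycles G
  open Configurations G
  open CrossingAppendices G
  open Equivalence using (to; from)

  tabulate-path : ∀ {m} (f : Fin m → V) → Injective _≡_ _≡_ f →
                  (∀ i j → E G (f i) (f j) ⇔ (suc (toℕ i) ≡ toℕ j ⊎ suc (toℕ j) ≡ toℕ i)) → InducedPath (tabulate f)
  tabulate-path f f-inj f-path = record
    { unique      = tabulate⁺ f-inj
    ; edge⇒consec = edge⇒consec′
    ; consec⇒edge = consec⇒edge′ }
    where
    edge⇒consec′ : ∀ {x y} → x ∈ tabulate f → y ∈ tabulate f → E G x y → Consec (tabulate f) x y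
    edge⇒consec′ mx my e with ∈-tabulate⁻ {f = f} mx | ∈-tabulate⁻ {f = f} my
    ... | i , refl | j , refl with to (f-path i j) e
    ... | inj₁ s = consec-tabulate⁺ f i j s
    ... | inj₂ s = consec-sym (consec-tabulate⁺ f j i s)
    consec⇒edge′ : ∀ {x y} → Consec (tabulate f) x y → E G x y
    consec⇒edge′ c with consec-tabulate⁻ f c
    ... | i , j , refl , refl , s = from (f-path i j) s

  module HoleAsList (H : Hole G) where
    K : ℕ
    K = 4 + len-4 H

    last : Fin K
    last = fromℕ (3 + len-4 H)

    successor : ∀ (i : Fin K) {j : Fin K} → suc (toℕ i) % K ≡ toℕ j → suc (toℕ i) ≡ toℕ j ⊎ (i ≡ last × j ≡ zero)
    successor i s with m≤n⇒m<n∨m≡n (toℕ<n i)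
    ... | inj₁ lt   = inj₁ (trans (sym (m<n⇒m%n≡m lt)) s)
    ... | inj₂ eq   = inj₂ ( toℕ-injective (trans (cong pred eq) (sym (toℕ-fromℕ _)))
                           , toℕ-injective (trans (sym s) (trans (cong (_% K) eq) (n%n≡0 K))))

    closing : tabulate (h H) ∷ʳ h H zero ≡ tabulate (h H ∘ inject₁) ++ h H last ∷ h H zero ∷ []
    closing = trans (cong (_∷ʳ h H zero) (tabulate-∷ʳ (h H))) (++-assoc (tabulate (h H ∘ inject₁)) [ h H last ] [ h H zero ])

    last-edge : E G (h H last) (h H zero)
    last-edge = from (h-cyc H last zero) (inj₁ (trans (cong (λ t → suc t % K) (toℕ-fromℕ (3 + len-4 H))) (n%n≡0 K)))

    hole-cycle : InducedCycle (tabulate (h H))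
    hole-cycle = record
      { cycle-unique    = tabulate⁺ (h-inj H)
      ; edge⇒cyc-consec = edge⇒cyc-consec′
      ; cyc-consec⇒edge = cyc-consec⇒edge′ }
      where
      step : ∀ i j → suc (toℕ i) % K ≡ toℕ j → CycConsec (tabulate (h H)) (h H i) (h H j)
      step i j s with successor i s
      ... | inj₁ s′ = consec-++⁺ˡ (consec-tabulate⁺ (h H) i j s′)
      ... | inj₂ (refl , refl) = subst (λ l → Consec l (h H last) (h H zero)) (sym closing) (consec-middle (tabulate (h H ∘ inject₁)))
      edge⇒cyc-consec′ : ∀ {x y} → x ∈ tabulate (h H) → y ∈ tabulate (h H) → E G x y → CycConsec (tabulate (h H)) x y
      edge⇒cyc-consec′ mx my e with ∈-tabulate⁻ {f = h H} mx | ∈-tabulate⁻ {f = h H} my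
      ... | i , refl | j , refl with to (h-cyc H i j) e
      ... | inj₁ s = step i j s
      ... | inj₂ s = consec-sym (step j i s)
      index-edge : ∀ i j → suc (toℕ i) ≡ toℕ j → E G (h H i) (h H j)
      index-edge i j s = from (h-cyc H i j) (inj₁ (trans (m<n⇒m%n≡m (subst (_< K) (sym s) (toℕ<n j))) s))
      cyc-consec⇒edge′ : ∀ {x y} → CycConsec (tabulate (h H)) x y → E G x y
      cyc-consec⇒edge′ {x} {y} c with consec-join⁻ (tabulate (h H ∘ inject₁)) (subst (λ l → Consec l x y) closing c)
      ... | inj₂ d = consec⇒edge (path-edge last-edge) d
      ... | inj₁ d with consec-tabulate⁻ (h H) (subst (λ l → Consec l x y) (sym (tabulate-∷ʳ (h H))) d)
      ...   | i , j , refl , refl , inj₁ s = index-edge i j s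
      ...   | i , j , refl , refl , inj₂ s = E-sym (index-edge j i s)

    record Corners (a b c d : V) : Set where
      field
        X₁ X₂ X₃ X₄     : List V
        corners-cycle   : InducedCycle (a ∷ X₁ ++ b ∷ X₂ ++ c ∷ X₃ ++ d ∷ X₄)
        corners-on-hole : ∀ {z} → z ∈ a ∷ X₁ ++ b ∷ X₂ ++ c ∷ X₃ ++ d ∷ X₄ → ∃ λ k → z ≡ h H k

    corners : ∀ {w₁ w₂ w₃ w₄} → toℕ w₁ < toℕ w₂ → toℕ w₂ < toℕ w₃ → toℕ w₃ < toℕ w₄ →
              Corners (h H w₁) (h H w₂) (h H w₃) (h H w₄)
    corners {w₁} {w₂} {w₃} {w₄} l₁₂ l₂₃ l₃₄ with tabulate-split₄ (h H) w₁ w₂ w₃ w₄ l₁₂ l₂₃ l₃₄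
    ... | L , M₁ , M₂ , M₃ , R , eq = record
      { X₁ = M₁ ; X₂ = M₂ ; X₃ = M₃ ; X₄ = R ++ L
      ; corners-cycle   = subst InducedCycle rest++L≡ (cycle-rotate L rest (subst InducedCycle eq hole-cycle))
      ; corners-on-hole = λ {z} m → ∈-tabulate⁻ {f = h H} (subst (z ∈_) (sym eq) (∈-rotate L (subst (z ∈_) (sym rest++L≡) m))) }
      where
      rest : List V
      rest = h H w₁ ∷ M₁ ++ h H w₂ ∷ M₂ ++ h H w₃ ∷ M₃ ++ h H w₄ ∷ R
      rest++L≡ : rest ++ L ≡ h H w₁ ∷ M₁ ++ h H w₂ ∷ M₂ ++ h H w₃ ∷ M₃ ++ h H w₄ ∷ R ++ L
      rest++L≡ = cong (h H w₁ ∷_)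
        (trans (++-assoc M₁ _ L) (cong (λ t → M₁ ++ h H w₂ ∷ t)
        (trans (++-assoc M₂ _ L) (cong (λ t → M₂ ++ h H w₃ ∷ t) (++-assoc M₃ _ L)))))

  module AppendixAsList (H : Hole G) (P : Appendix H) where
    a c : V
    a = h H (u₁ P)
    c = h H (u₂ P)

    u₁≢u₂ : u₁ P ≢ u₂ P
    u₁≢u₂ with attach P
    ... | inj₁ (_ , ne , _) = ne
    ... | inj₂ (_ , ne , _) = ne

    single-vertex : l P ≡ 0 → ∀ (i j : Fin (suc (l P))) → i ≡ j
    single-vertex l≡0 i j = toℕ-injective (trans (toℕ≡0 i) (sym (toℕ≡0 j)))
      where toℕ≡0 = λ (k : Fin (suc (l P))) → n≤0⇒n≡0 (subst (toℕ k ≤_) l≡0 (≤-pred (toℕ<n k)))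

    first-edge : E G (p P zero) a
    first-edge with attach P
    ... | inj₁ (_ , _ , _ , att)  = from (att (u₁ P)) (inj₁ refl)
    ... | inj₂ (_ , _ , att₁ , _) = from (att₁ (u₁ P)) refl

    last-edge : E G (p P (fromℕ (l P))) c
    last-edge with attach P
    ... | inj₁ (l≡0 , _ , _ , att) = subst (λ k → E G (p P k) c) (single-vertex l≡0 zero _) (from (att (u₂ P)) (inj₂ refl))
    ... | inj₂ (_ , _ , _ , att₂)  = from (att₂ (u₂ P)) refl

    hole-edge : ∀ i k → E G (p P i) (h H k) → (i ≡ zero × k ≡ u₁ P) ⊎ (i ≡ fromℕ (l P) × k ≡ u₂ P)
    hole-edge i k e with attach P
    ... | inj₁ (l≡0 , _ , _ , att) with to (att k) (subst (λ j → E G (p P j) (h H k)) (single-vertex l≡0 i zero) e)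
    ...   | inj₁ k≡u₁ = inj₁ (single-vertex l≡0 i zero , k≡u₁)
    ...   | inj₂ k≡u₂ = inj₂ (single-vertex l≡0 i _ , k≡u₂)
    hole-edge i k e | inj₂ (_ , _ , att₁ , att₂) with toℕ i Data.Nat.≟ 0 | toℕ i Data.Nat.≟ l P
    ... | yes i≡0 | _     = inj₁ (i≡zero , to (att₁ k) (subst (λ j → E G (p P j) (h H k)) i≡zero e))
      where i≡zero = toℕ-injective i≡0
    ... | no _    | yes i≡l = inj₂ (i≡last , to (att₂ k) (subst (λ j → E G (p P j) (h H k)) i≡last e))
      where i≡last = toℕ-injective (trans i≡l (sym (toℕ-fromℕ (l P))))
    ... | no i≢0  | no i≢l = ⊥-elim (interior P i (≤∧≢⇒< z≤n (λ 0≡i → i≢0 (sym 0≡i))) (≤∧≢⇒< (≤-pred (toℕ<n i)) i≢l) k e)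

    ps : List V
    ps = tabulate (p P)

    ps-path : InducedPath (ps ∷ʳ c)
    ps-path = subst InducedPath (trans (sym (++-assoc T [ ℓ ] [ c ])) (cong (_∷ʳ c) (sym ps≡))) joined
      where
      T : List V
      T = tabulate (p P ∘ inject₁)
      ℓ : V
      ℓ = p P (fromℕ (l P))
      ps≡ : ps ≡ T ∷ʳ ℓ
      ps≡ = tabulate-∷ʳ (p P)
      in-ps : ∀ {v} → v ∈ T ∷ʳ ℓ → ∃ λ i → v ≡ p P i
      in-ps {v} m = ∈-tabulate⁻ {f = p P} (subst (v ∈_) (sym ps≡) m)
      cross : ∀ {x y} → x ∈ T ∷ʳ ℓ → y ∈ ℓ ∷ c ∷ [] → E G x y → x ≡ ℓ ⊎ y ≡ ℓ
      cross _  (here q)          _ = inj₂ q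
      cross mx (there (here refl)) e with in-ps mx
      ... | i , refl with hole-edge i (u₂ P) e
      ...   | inj₁ (_ , u₂≡u₁) = ⊥-elim (u₁≢u₂ (sym u₂≡u₁))
      ...   | inj₂ (refl , _)  = inj₁ refl
      meet : ∀ {x} → x ∈ T ∷ʳ ℓ → x ∈ ℓ ∷ c ∷ [] → x ≡ ℓ
      meet _  (here q)            = q
      meet mx (there (here refl)) with in-ps mx
      ... | i , eq = ⊥-elim (p-off P i (u₂ P) (sym eq))
      joined : InducedPath (T ++ ℓ ∷ c ∷ [])
      joined = path-join T ℓ [ c ] (subst InducedPath ps≡ (tabulate-path (p P) (p-inj P) (p-chordless P)))
                 (path-edge last-edge) cross meet

    as-list : ∀ Z → (∀ {z} → z ∈ Z → ∃ λ k → z ≡ h H k) → ¬ E G a c → ListAppendix Z a c ps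
    as-list Z on-hole a≁c = record
      { appendix-path   = path-cons (E-sym first-edge) a∉ a≁ ps-path
      ; appendix-off    = off
      ; appendix-attach = attach′ }
      where
      a∉ : a ∉ ps ∷ʳ c
      a∉ m with ∈-++⁻ ps m
      ... | inj₂ (here eq) = u₁≢u₂ (h-inj H eq)
      ... | inj₁ q with ∈-tabulate⁻ {f = p P} q
      ...   | i , eq = p-off P i (u₁ P) (sym eq)
      a≁ : ∀ {z} → z ∈ tabulate (p P ∘ suc) ∷ʳ c → ¬ E G a z
      a≁ m e with ∈-++⁻ (tabulate (p P ∘ suc)) m
      ... | inj₂ (here refl) = a≁c e
      ... | inj₁ q with ∈-tabulate⁻ {f = p P ∘ suc} q
      ...   | i , refl with hole-edge (suc i) (u₁ P) (E-sym e)
      ...     | inj₁ (() , _)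
      ...     | inj₂ (_ , u₁≡u₂) = u₁≢u₂ u₁≡u₂
      off : ∀ {v} → v ∈ ps → v ∉ Z
      off m mz with ∈-tabulate⁻ {f = p P} m | on-hole mz
      ... | i , refl | k , eq = p-off P i k eq
      attach′ : ∀ {v z} → v ∈ ps → z ∈ Z → E G v z → z ≡ a ⊎ z ≡ c
      attach′ m mz e with ∈-tabulate⁻ {f = p P} m | on-hole mz
      ... | i , refl | k , refl with hole-edge i k e
      ...   | inj₁ (_ , refl) = inj₁ refl
      ...   | inj₂ (_ , refl) = inj₂ refl

  module Crossings (H : Hole G) where
    open HoleAsList H

    Ends : Appendix H → Fin K → Fin K → Set
    Ends A s t = (u₁ A ≡ s × u₂ A ≡ t) ⊎ (u₁ A ≡ t × u₂ A ≡ s)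

    oriented : ∀ (A : Appendix H) {s t} → Ends A s t → ∀ Z → (∀ {z} → z ∈ Z → ∃ λ k → z ≡ h H k) →
               ¬ E G (h H s) (h H t) → ∃ λ L → ListAppendix Z (h H s) (h H t) L
    oriented A (inj₁ (refl , refl)) Z on-hole s≁t = _ , AppendixAsList.as-list H A Z on-hole s≁t
    oriented A (inj₂ (refl , refl)) Z on-hole s≁t = _ , appendix-reverse (AppendixAsList.as-list H A Z on-hole (λ e → s≁t (E-sym e)))

    crossing-at : ∀ {w₁ w₂ w₃ w₄} → toℕ w₁ < toℕ w₂ → toℕ w₂ < toℕ w₃ → toℕ w₃ < toℕ w₄ →
                  ∀ A B → Ends A w₁ w₃ → Ends B w₂ w₄ → HasISK4 G ⊎ Contains G K33
    crossing-at l₁₂ l₂₃ l₃₄ A B ends-A ends-B =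
      crossing-appendices⇒ISK4⊎K33 corners-cycle
        (proj₂ (oriented A ends-A _ corners-on-hole (cycle-opposite-nonadjacent X₁ X₂ X₃ X₄ corners-cycle)))
        (proj₂ (oriented B ends-B _ corners-on-hole (cycle-opposite-nonadjacent X₂ X₃ X₄ X₁ (cycle-rotate₄ corners-cycle))))
      where open Corners (corners l₁₂ l₂₃ l₃₄)

    strictly-inside : ∀ {s t x : Fin K} → InSector s t x → h H x ≢ h H s → h H x ≢ h H t →
                      (toℕ s < toℕ x × toℕ x < toℕ t) ⊎ (toℕ t < toℕ s × (toℕ s < toℕ x ⊎ toℕ x < toℕ t))
    strictly-inside (inj₁ refl)               x≢s _   = ⊥-elim (x≢s refl)
    strictly-inside (inj₂ (inj₁ refl))        _   x≢t = ⊥-elim (x≢t refl)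
    strictly-inside (inj₂ (inj₂ (inj₁ in₁))) _   _   = inj₁ in₁
    strictly-inside (inj₂ (inj₂ (inj₂ in₂))) _   _   = inj₂ in₂

    crossing⇒ISK4⊎K33 : ∀ (P Q : Appendix H) → Crossing P Q → HasISK4 G ⊎ Contains G K33
    crossing⇒ISK4⊎K33 P Q (d₁ , d₂ , d₃ , d₄ , inj₁ (s₁ , s₂))
      with strictly-inside s₁ (λ e → d₁ (sym e)) (λ e → d₃ (sym e)) | strictly-inside s₂ (λ e → d₄ (sym e)) (λ e → d₂ (sym e))
    ... | inj₁ (αγ , γβ)      | inj₁ (βδ , δα)      = ⊥-elim (<-asym (<-trans αγ γβ) (<-trans βδ δα))
    ... | inj₁ (αγ , γβ)      | inj₂ (_ , inj₁ βδ) = crossing-at αγ γβ βδ P Q (inj₁ (refl , refl)) (inj₁ (refl , refl))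
    ... | inj₁ (αγ , γβ)      | inj₂ (_ , inj₂ δα) = crossing-at δα αγ γβ Q P (inj₂ (refl , refl)) (inj₁ (refl , refl))
    ... | inj₂ (βα , inj₁ αγ) | inj₁ (βδ , δα)      = crossing-at βδ δα αγ P Q (inj₂ (refl , refl)) (inj₂ (refl , refl))
    ... | inj₂ (βα , inj₂ γβ) | inj₁ (βδ , δα)      = crossing-at γβ βδ δα Q P (inj₁ (refl , refl)) (inj₂ (refl , refl))
    ... | inj₂ (βα , _)       | inj₂ (αβ , _)       = ⊥-elim (<-asym αβ βα)
    crossing⇒ISK4⊎K33 P Q (d₁ , d₂ , d₃ , d₄ , inj₂ (s₁ , s₂))
      with strictly-inside s₁ (λ e → d₂ (sym e)) (λ e → d₄ (sym e)) | strictly-inside s₂ (λ e → d₃ (sym e)) (λ e → d₁ (sym e))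
    ... | inj₁ (αδ , δβ)      | inj₁ (βγ , γα)      = ⊥-elim (<-asym (<-trans αδ δβ) (<-trans βγ γα))
    ... | inj₁ (αδ , δβ)      | inj₂ (_ , inj₁ βγ) = crossing-at αδ δβ βγ P Q (inj₁ (refl , refl)) (inj₂ (refl , refl))
    ... | inj₁ (αδ , δβ)      | inj₂ (_ , inj₂ γα) = crossing-at γα αδ δβ Q P (inj₁ (refl , refl)) (inj₁ (refl , refl))
    ... | inj₂ (βα , inj₁ αδ) | inj₁ (βγ , γα)      = crossing-at βγ γα αδ P Q (inj₂ (refl , refl)) (inj₁ (refl , refl))
    ... | inj₂ (βα , inj₂ δβ) | inj₁ (βγ , γα)      = crossing-at δβ βγ γα Q P (inj₂ (refl , refl)) (inj₂ (refl , refl))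
    ... | inj₂ (βα , _)       | inj₂ (αβ , _)       = ⊥-elim (<-asym αβ βα)

lemma3p1 : ∀ {n : ℕ} (G : Graph n) → ¬ HasISK4 G → ¬ Contains G K33 →
           (H : Hole G) (P Q : Appendix H) → ¬ Crossing P Q
lemma3p1 G no-ISK4 no-K33 H P Q crossing =
  [ no-ISK4 , no-K33 ]′ (FromRecords.Crossings.crossing⇒ISK4⊎K33 G H P Q crossing)
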